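{- For every integer $n\ge 1$, $\mathrm{a}_{021,102}(n)=3\cdot 2^{n-1}-\binom{n+1}{2}-1$. Equivalently, $|\mathcal{A}_{021,102}(n)|$ equals the number of permutations of $\{1,\dots,n\}$ avoiding both $123$ and $3241$.
   Context: An ascent of an integer word $x_1\cdots x_n$ is an index $j$ with $x_j<x_{j+1}$; $\mathrm{asc}(x_1\cdots x_n)$ denotes the number of ascents. An ascent sequence of length $n$ is a sequence $x_1\cdots x_n$ of nonnegative integers with $x_1=0$ and $x_i\le \mathrm{asc}(x_1\cdots x_{i-1})+1$ for all $1<i\le n$. A pattern is a word $p=p_1\cdots p_k$ of nonnegative integers whose set of values is $\{0,1,\dots,m\}$ for some $m$. A word $x_1\cdots x_n$ contains $p$ if there are indices $i_1<\cdots<i_k$ such that $x_{i_1}\cdots x_{i_k}$ is order-isomorphic to $p$ (i.e. for all $s,t$, $x_{i_s}<x_{i_t}$ iff $p_s<p_t$ and $x_{i_s}=x_{i_t}$ iff $p_s=p_t$); otherwise it avoids $p$. For a list $B$ of patterns, $\mathcal{A}_B(n)$ is the set of ascent sequences of length $n$ avoiding every pattern in $B$, and $\mathrm{a}_B(n)=|\mathcal{A}_B(n)|$. Permutation pattern avoidance is the classical notion: a permutation $\pi$ avoids $\sigma$ if no subsequence of $\pi$ is order-isomorphic to $\sigma$. -}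

module Defs where

open import Data.Nat using (ℕ; zero; suc; _+_; _<_; _≤_; _<ᵇ_)
open import Data.Bool using (if_then_else_)
open import Data.List using (List; []; _∷_; length; lookup; take; map; upTo)
open import Data.Fin using (Fin; toℕ; cast)
open import Data.Product using (Σ; ∃; _×_)
open import Relation.Binary.PropositionalEquality using (_≡_)
open import Relation.Nullary using (¬_)
open import Data.Empty using (⊥)
open import Function.Bundles using (_⇔_)
open import Data.List.Membership.Propositional using (_∈_)
open import Data.List.Relation.Unary.Unique.Propositional using (Unique)
open import Data.List.Relation.Binary.Sublist.Propositional using (_⊆_)
open import Data.List.Relation.Binary.Permutation.Propositional using (_↭_)

asc : List ℕ → ℕ
asc [] = 0
asc (x ∷ []) = 0
asc (x ∷ y ∷ xs) = (if x <ᵇ y then 1 else 0) + asc (y ∷ xs)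

-- ascent sequence: x₁ = 0 and x_i ≤ asc(x₁⋯x_{i-1}) + 1 for 1 < i ≤ n
-- (positions are 0-based here: position i ≥ 1 has prefix take i w)
IsAscentSeq : List ℕ → Set
IsAscentSeq [] = ⊥
IsAscentSeq (x ∷ xs) =
  x ≡ 0 × ((i : Fin (length (x ∷ xs))) → 1 ≤ toℕ i →
            lookup (x ∷ xs) i ≤ asc (take (toℕ i) (x ∷ xs)) + 1)

OrderIso : List ℕ → List ℕ → Set
OrderIso u p = Σ (length u ≡ length p) λ eq →
  (i j : Fin (length u)) →
    ((lookup u i < lookup u j) ⇔ (lookup p (cast eq i) < lookup p (cast eq j))) ×
    ((lookup u i ≡ lookup u j) ⇔ (lookup p (cast eq i) ≡ lookup p (cast eq j)))

Contains : List ℕ → List ℕ → Set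
Contains w p = ∃ λ u → u ⊆ w × OrderIso u p

Avoids : List ℕ → List ℕ → Set
Avoids w p = ¬ Contains w p

HasCard : {A : Set} → (A → Set) → ℕ → Set
HasCard {A} P k = Σ (List A) λ L → Unique L × ((x : A) → (x ∈ L ⇔ P x)) × length L ≡ k

AscAvoid021-102 : ℕ → List ℕ → Set
AscAvoid021-102 n w = IsAscentSeq w × length w ≡ n ×
  Avoids w (0 ∷ 2 ∷ 1 ∷ []) × Avoids w (1 ∷ 0 ∷ 2 ∷ [])

PermAvoid123-3241 : ℕ → List ℕ → Set
PermAvoid123-3241 n w = w ↭ map suc (upTo n) ×
  Avoids w (1 ∷ 2 ∷ 3 ∷ []) × Avoids w (3 ∷ 2 ∷ 4 ∷ 1 ∷ [])

-- Both families are the levels of generating trees in which every object of size n + 1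
-- arises from exactly one object of size n.  An ascent sequence avoiding 021 and 102 grows
-- by appending a letter: while it is a staircase 0…0 1…1 … m…m it may repeat m, climb to
-- m + 1, or fall back to 0; after a fall from 1 only 0s and 1s can follow, after a fall from
-- m ≥ 2 only 0s.  A permutation avoiding 123 and 3241 grows by inserting its new maximum,
-- which may only go in front, after the first letter, or directly after the maximal
-- decreasing prefix A when no later letter lies below the second letter of A.  In both
-- trees the labels of the children of a node depend only on its label, so the level sizes
-- obey linear recurrences, and for both roots these solve to 3·2ⁿ⁻¹ − C(n+1,2) − 1.

module Submission where

open import Defs
open import Data.Nat using (ℕ; zero; suc; _+_; _*_; _^_; _∸_; _<_; _≤_; z≤n; s≤s; z<s; s<s; _<ᵇ_; _≟_; _≤?_; _<?_)
open import Data.Nat.Properties using (≤⇒≯; <-trans; <-irrefl; <-asym; <-cmp; ∸-monoˡ-<; +-suc; +-identityʳ; +-assoc; +-comm; ≤-refl; <⇒≤; ≤-pred; ≤∧≢⇒<; n≤1+n; ≤-trans; suc-injective; <⇒≢; n<1+n; m≤m+n; m≤n+m; ≤-reflexive; m≤n⇒m≤1+n; ≤-<-trans; <-≤-trans; n≮0; ≤-antisym; +-cancelʳ-≡)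
open import Data.Nat.Combinatorics using (_C_; nCk+nC[k+1]≡[n+1]C[k+1]; nC1≡n)
open import Data.Nat.ListAction using (sum)
open import Data.Nat.ListAction.Properties using (sum-++)
open import Data.Nat.Tactic.RingSolver using (solve-∀)
open import Data.Bool using (if_then_else_)
open import Data.Empty using (⊥-elim)
open import Data.Unit using (⊤; tt)
open import Data.Fin using (Fin; toℕ; fromℕ<; cast) renaming (zero to fz; suc to fs)
open import Data.Fin.Properties using (toℕ<n; toℕ-fromℕ<)
open import Data.Product using (Σ; ∃; ∃₂; _×_; _,_; proj₁; proj₂)
open import Data.Sum using (_⊎_; inj₁; inj₂)
open import Data.List using (List; []; _∷_; length; lookup; map; _++_; [_]; take; drop; filter; upTo; concatMap; initLast; _∷ʳ′_)
open import Data.List.Properties using (length-map; map-++; map-cong; map-∘; ++-identityʳ; take-all; length-++; ++-assoc; ∷ʳ-injectiveʳ; upTo-∷ʳ; filter-++; filter-all; filter-reject; ∷-injectiveˡ; ∷-injectiveʳ)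
open import Data.List.Membership.Propositional using (_∈_; find; lose)
open import Data.List.Membership.Propositional.Properties using (∈-lookup; ∈-map⁺; ∈-map⁻; ∈-++⁺ˡ; ∈-++⁺ʳ; ∈-upTo⁻; ∈-∃++; ∈-concatMap⁺; ∈-concatMap⁻)
open import Data.List.Relation.Unary.Any using (Any; here; there)
import Data.List.Relation.Unary.Any as Any
open import Data.List.Relation.Unary.All using (All; []; _∷_; all?)
import Data.List.Relation.Unary.All as All
open import Data.List.Relation.Unary.All.Properties using (All¬⇒¬Any) renaming (++⁺ to All-++⁺; ++⁻ˡ to All-++⁻ˡ; ++⁻ʳ to All-++⁻ʳ)
open import Data.List.Relation.Unary.AllPairs using (AllPairs; []; _∷_)
open import Data.List.Relation.Unary.Linked using (Linked; [-]; _∷_)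
open import Data.List.Relation.Unary.Unique.Propositional using (Unique)
import Data.List.Relation.Unary.Unique.Propositional.Properties as Unique
open import Data.List.Relation.Binary.Sublist.Propositional using (_⊆_; []; _∷_; _∷ʳ_; to∈; from∈; ⊆-refl; ⊆-trans)
open import Data.List.Relation.Binary.Sublist.Propositional.Properties using (++⁺; ++⁺ʳ; ∷ˡ⁻; length-mono-≤; []⊆-universal)
open import Data.List.Relation.Binary.Permutation.Propositional using (_↭_; ↭-refl; ↭-sym; ↭-trans; prep)
open import Data.List.Relation.Binary.Permutation.Propositional.Properties using (shift; drop-∷; ∈-resp-↭; ∷↭∷ʳ; ↭-singleton-inv)
open import Function using (_∘_)
open import Function.Bundles using (_⇔_; mk⇔; Equivalence)
open import Relation.Binary.Definitions using (tri<; tri≈; tri>)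
open import Relation.Binary.PropositionalEquality using (_≡_; _≢_; refl; sym; trans; cong; cong₂; subst; module ≡-Reasoning)
open import Relation.Nullary using (¬_; yes; no; contradiction)
open import Relation.Nullary.Decidable using (True; toWitness; _×-dec_)

-- Pattern occurrences

lookupℕ : List ℕ → ℕ → ℕ
lookupℕ []       _       = 0
lookupℕ (x ∷ xs) zero    = x
lookupℕ (x ∷ xs) (suc i) = lookupℕ xs i

lookup-map : (f : ℕ → ℕ) (p : List ℕ) (i : Fin (length (map f p))) →
             lookup (map f p) i ≡ f (lookup p (cast (length-map f p) i))
lookup-map f (x ∷ p) fz     = refl
lookup-map f (x ∷ p) (fs i) = lookup-map f p i

strictMono⇒reflects : ∀ (f : ℕ → ℕ) {a b} → (a < b → f a < f b) → (b < a → f b < f a) →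
                      ((f a < f b) ⇔ (a < b)) × ((f a ≡ f b) ⇔ (a ≡ b))
strictMono⇒reflects f {a} {b} mono mono′ with <-cmp a b
... | tri< a<b _ _ = mk⇔ (λ _ → a<b) (λ _ → mono a<b) ,
                     mk⇔ (λ eq → ⊥-elim (<-irrefl eq (mono a<b))) (λ eq → ⊥-elim (<-irrefl eq a<b))
... | tri≈ _ refl _ = mk⇔ (λ lt → ⊥-elim (<-irrefl refl lt)) (λ lt → ⊥-elim (<-irrefl refl lt)) ,
                      mk⇔ (λ _ → refl) (λ _ → refl)
... | tri> _ _ b<a = mk⇔ (λ lt → ⊥-elim (<-asym lt (mono′ b<a))) (λ lt → ⊥-elim (<-asym lt b<a)) ,
                     mk⇔ (λ eq → ⊥-elim (<-irrefl (sym eq) (mono′ b<a)))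
                         (λ eq → ⊥-elim (<-irrefl (sym eq) b<a))

orderIso-map : (f : ℕ → ℕ) (p : List ℕ) →
               (∀ {x y} → x ∈ p → y ∈ p → x < y → f x < f y) → OrderIso (map f p) p
orderIso-map f p mono = length-map f p , λ i j →
  along (lookup-map f p i) (lookup-map f p j)
    (strictMono⇒reflects f (mono (∈-lookup _) (∈-lookup _)) (mono (∈-lookup _) (∈-lookup _)))
  where
  along : ∀ {u v a b} → u ≡ f a → v ≡ f b → ((f a < f b) ⇔ (a < b)) × ((f a ≡ f b) ⇔ (a ≡ b)) →
            ((u < v) ⇔ (a < b)) × ((u ≡ v) ⇔ (a ≡ b))
  along refl refl r = r

lookupℕ-mono : ∀ {vs} i j → Linked _<_ vs → i < j → j < length vs → lookupℕ vs i < lookupℕ vs j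
lookupℕ-mono zero    (suc zero)    (v<w ∷ _)   _         _        = v<w
lookupℕ-mono zero    (suc (suc j)) (v<w ∷ vs↗) _         (s≤s j<) =
  <-trans v<w (lookupℕ-mono 0 (suc j) vs↗ z<s j<)
lookupℕ-mono (suc i) (suc j)       (_ ∷ vs↗)   (s≤s i<j) (s≤s j<) = lookupℕ-mono i j vs↗ i<j j<
lookupℕ-mono _       (suc _)       [-]         _         (s≤s ())

-- lo is the least letter of the pattern (1 for 123 and 3241); for a concrete pattern the
-- range condition below is decided by evaluation, so it never has to be supplied.
relabel : ℕ → List ℕ → ℕ → ℕ
relabel lo vs x = lookupℕ vs (x ∸ lo)

contains-relabel : ∀ lo vs p {w} → Linked _<_ vs →
                   {True (all? (λ v → (lo ≤? v) ×-dec (v ∸ lo <? length vs)) p)} →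
                   map (relabel lo vs) p ⊆ w → Contains w p
contains-relabel lo vs p vs↗ {range} s =
  map (relabel lo vs) p , s , orderIso-map (relabel lo vs) p mono
  where
  inRange : All (λ v → lo ≤ v × v ∸ lo < length vs) p
  inRange = toWitness range
  mono : ∀ {x y} → x ∈ p → y ∈ p → x < y → relabel lo vs x < relabel lo vs y
  mono x∈ y∈ x<y with All.lookup inRange x∈ | All.lookup inRange y∈
  ... | lo≤x , _ | _ , y< = lookupℕ-mono _ _ vs↗ (∸-monoˡ-< x<y lo≤x) y<

Occurs3 : (ℕ → ℕ → ℕ → Set) → List ℕ → Set
Occurs3 R w = ∃ λ a → ∃ λ b → ∃ λ c → (a ∷ b ∷ c ∷ []) ⊆ w × R a b c

Occurs4 : (ℕ → ℕ → ℕ → ℕ → Set) → List ℕ → Set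
Occurs4 R w = ∃ λ a → ∃ λ b → ∃ λ c → ∃ λ d → (a ∷ b ∷ c ∷ d ∷ []) ⊆ w × R a b c d

Shape021 Shape102 Shape123 : ℕ → ℕ → ℕ → Set
Shape021 a b c = a < c × c < b
Shape102 a b c = b < a × a < c
Shape123 a b c = a < b × b < c

Shape3241 : ℕ → ℕ → ℕ → ℕ → Set
Shape3241 a b c d = d < b × b < a × a < c

orderIso⇒< : ∀ {u p} (iso : OrderIso u p) (i j : Fin (length u)) →
             lookup p (cast (proj₁ iso) i) < lookup p (cast (proj₁ iso) j) → lookup u i < lookup u j
orderIso⇒< (_ , iso) i j = Equivalence.from (proj₁ (iso i j))

length≡3 : ∀ (u : List ℕ) → length u ≡ 3 → ∃ λ a → ∃ λ b → ∃ λ c → u ≡ a ∷ b ∷ c ∷ []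
length≡3 (a ∷ b ∷ c ∷ []) refl = a , b , c , refl

length≡4 : ∀ (u : List ℕ) → length u ≡ 4 → ∃ λ a → ∃ λ b → ∃ λ c → ∃ λ d → u ≡ a ∷ b ∷ c ∷ d ∷ []
length≡4 (a ∷ b ∷ c ∷ d ∷ []) refl = a , b , c , d , refl

contains⇔occurs021 : ∀ {w} → Contains w (0 ∷ 2 ∷ 1 ∷ []) ⇔ Occurs3 Shape021 w
contains⇔occurs021 = mk⇔ to from
  where
  to : ∀ {w} → Contains w (0 ∷ 2 ∷ 1 ∷ []) → Occurs3 Shape021 w
  to (u , s , iso) with length≡3 u (proj₁ iso)
  ... | a , b , c , refl =
    a , b , c , s , orderIso⇒< iso fz (fs (fs fz)) z<s , orderIso⇒< iso (fs (fs fz)) (fs fz) (s<s z<s)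
  from : ∀ {w} → Occurs3 Shape021 w → Contains w (0 ∷ 2 ∷ 1 ∷ [])
  from (a , b , c , s , a<c , c<b) = contains-relabel 0 (a ∷ c ∷ b ∷ []) _ (a<c ∷ c<b ∷ [-]) s

contains⇔occurs102 : ∀ {w} → Contains w (1 ∷ 0 ∷ 2 ∷ []) ⇔ Occurs3 Shape102 w
contains⇔occurs102 = mk⇔ to from
  where
  to : ∀ {w} → Contains w (1 ∷ 0 ∷ 2 ∷ []) → Occurs3 Shape102 w
  to (u , s , iso) with length≡3 u (proj₁ iso)
  ... | a , b , c , refl =
    a , b , c , s , orderIso⇒< iso (fs fz) fz z<s , orderIso⇒< iso fz (fs (fs fz)) (s<s z<s)
  from : ∀ {w} → Occurs3 Shape102 w → Contains w (1 ∷ 0 ∷ 2 ∷ [])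
  from (a , b , c , s , b<a , a<c) = contains-relabel 0 (b ∷ a ∷ c ∷ []) _ (b<a ∷ a<c ∷ [-]) s

contains⇔occurs123 : ∀ {w} → Contains w (1 ∷ 2 ∷ 3 ∷ []) ⇔ Occurs3 Shape123 w
contains⇔occurs123 = mk⇔ to from
  where
  to : ∀ {w} → Contains w (1 ∷ 2 ∷ 3 ∷ []) → Occurs3 Shape123 w
  to (u , s , iso) with length≡3 u (proj₁ iso)
  ... | a , b , c , refl =
    a , b , c , s , orderIso⇒< iso fz (fs fz) (s<s z<s) ,
    orderIso⇒< iso (fs fz) (fs (fs fz)) (s<s (s<s z<s))
  from : ∀ {w} → Occurs3 Shape123 w → Contains w (1 ∷ 2 ∷ 3 ∷ [])
  from (a , b , c , s , a<b , b<c) = contains-relabel 1 (a ∷ b ∷ c ∷ []) _ (a<b ∷ b<c ∷ [-]) s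

contains⇔occurs3241 : ∀ {w} → Contains w (3 ∷ 2 ∷ 4 ∷ 1 ∷ []) ⇔ Occurs4 Shape3241 w
contains⇔occurs3241 = mk⇔ to from
  where
  to : ∀ {w} → Contains w (3 ∷ 2 ∷ 4 ∷ 1 ∷ []) → Occurs4 Shape3241 w
  to (u , s , iso) with length≡4 u (proj₁ iso)
  ... | a , b , c , d , refl = a , b , c , d , s ,
    orderIso⇒< iso (fs (fs (fs fz))) (fs fz) (s<s z<s) ,
    orderIso⇒< iso (fs fz) fz (s<s (s<s z<s)) ,
    orderIso⇒< iso fz (fs (fs fz)) (s<s (s<s (s<s z<s)))
  from : ∀ {w} → Occurs4 Shape3241 w → Contains w (3 ∷ 2 ∷ 4 ∷ 1 ∷ [])
  from (a , b , c , d , s , d<b , b<a , a<c) =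
    contains-relabel 1 (d ∷ b ∷ a ∷ c ∷ []) _ (d<b ∷ b<a ∷ a<c ∷ [-]) s

⊆-++-∷⁻ : ∀ (A : List ℕ) {N B u} → u ⊆ A ++ N ∷ B →
          u ⊆ A ++ B ⊎ ∃₂ λ u₁ u₂ → u ≡ u₁ ++ N ∷ u₂ × u₁ ⊆ A × u₂ ⊆ B
⊆-++-∷⁻ []      (_ ∷ʳ s)    = inj₁ s
⊆-++-∷⁻ []      (refl ∷ s)  = inj₂ ([] , _ , refl , [] , s)
⊆-++-∷⁻ (a ∷ A) (.a ∷ʳ s) with ⊆-++-∷⁻ A s
... | inj₁ s′                     = inj₁ (a ∷ʳ s′)
... | inj₂ (u₁ , u₂ , eq , s₁ , s₂) = inj₂ (u₁ , u₂ , eq , a ∷ʳ s₁ , s₂)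
⊆-++-∷⁻ (a ∷ A) (refl ∷ s) with ⊆-++-∷⁻ A s
... | inj₁ s′                     = inj₁ (refl ∷ s′)
... | inj₂ (u₁ , u₂ , eq , s₁ , s₂) = inj₂ (a ∷ u₁ , u₂ , cong (a ∷_) eq , refl ∷ s₁ , s₂)

occurs3-insert : ∀ {R} (A : List ℕ) {N B} → Occurs3 R (A ++ N ∷ B) →
                 Occurs3 R (A ++ B)
                 ⊎ (∃₂ λ b c → (b ∷ c ∷ []) ⊆ B × R N b c)
                 ⊎ (∃₂ λ a c → a ∈ A × c ∈ B × R a N c)
                 ⊎ (∃₂ λ a b → (a ∷ b ∷ []) ⊆ A × R a b N)
occurs3-insert A (a , b , c , s , r) with ⊆-++-∷⁻ A s
... | inj₁ s′                                   = inj₁ (a , b , c , s′ , r)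
... | inj₂ ([] , _ , refl , _ , s₂)              = inj₂ (inj₁ (b , c , s₂ , r))
... | inj₂ (_ ∷ [] , _ , refl , s₁ , s₂)         = inj₂ (inj₂ (inj₁ (a , c , to∈ s₁ , to∈ s₂ , r)))
... | inj₂ (_ ∷ _ ∷ [] , _ , refl , s₁ , _)      = inj₂ (inj₂ (inj₂ (a , b , s₁ , r)))
... | inj₂ (_ ∷ _ ∷ _ ∷ [] , _ , () , _)
... | inj₂ (_ ∷ _ ∷ _ ∷ _ ∷ _ , _ , () , _)

occurs4-insert : ∀ {R} (A : List ℕ) {N B} → Occurs4 R (A ++ N ∷ B) →
                 Occurs4 R (A ++ B)
                 ⊎ (∃₂ λ b c → ∃ λ d → (b ∷ c ∷ d ∷ []) ⊆ B × R N b c d)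
                 ⊎ (∃₂ λ a c → ∃ λ d → a ∈ A × (c ∷ d ∷ []) ⊆ B × R a N c d)
                 ⊎ (∃₂ λ a b → ∃ λ d → (a ∷ b ∷ []) ⊆ A × d ∈ B × R a b N d)
                 ⊎ (∃₂ λ a b → ∃ λ c → (a ∷ b ∷ c ∷ []) ⊆ A × R a b c N)
occurs4-insert A (a , b , c , d , s , r) with ⊆-++-∷⁻ A s
... | inj₁ s′                                   = inj₁ (a , b , c , d , s′ , r)
... | inj₂ ([] , _ , refl , _ , s₂)              = inj₂ (inj₁ (b , c , d , s₂ , r))
... | inj₂ (_ ∷ [] , _ , refl , s₁ , s₂)         = inj₂ (inj₂ (inj₁ (a , c , d , to∈ s₁ , s₂ , r)))
... | inj₂ (_ ∷ _ ∷ [] , _ , refl , s₁ , s₂)     = inj₂ (inj₂ (inj₂ (inj₁ (a , b , d , s₁ , to∈ s₂ , r))))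
... | inj₂ (_ ∷ _ ∷ _ ∷ [] , _ , refl , s₁ , _)  = inj₂ (inj₂ (inj₂ (inj₂ (a , b , c , s₁ , r))))
... | inj₂ (_ ∷ _ ∷ _ ∷ _ ∷ [] , _ , () , _)
... | inj₂ (_ ∷ _ ∷ _ ∷ _ ∷ _ ∷ _ , _ , () , _)

contains-⊆ : ∀ {u w p} → u ⊆ w → Contains u p → Contains w p
contains-⊆ u⊆w (v , v⊆u , iso) = v , ⊆-trans v⊆u u⊆w , iso

contains⇒length≤ : ∀ {w p} → Contains w p → length p ≤ length w
contains⇒length≤ {w} (u , u⊆w , len≡ , _) = subst (_≤ length w) len≡ (length-mono-≤ u⊆w)

shorter-avoids : ∀ {w p} → length w < length p → Avoids w p
shorter-avoids {p = p} w<p c = <-irrefl refl (<-≤-trans w<p (contains⇒length≤ {p = p} c))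

-- Generating trees

sum-map-concatMap : ∀ {A B : Set} (h : B → ℕ) (f : A → List B) (xs : List A) →
                    sum (map h (concatMap f xs)) ≡ sum (map (λ x → sum (map h (f x))) xs)
sum-map-concatMap h f []       = refl
sum-map-concatMap h f (x ∷ xs) = begin
  sum (map h (f x ++ concatMap f xs))
    ≡⟨ cong sum (map-++ h (f x) (concatMap f xs)) ⟩
  sum (map h (f x) ++ map h (concatMap f xs))
    ≡⟨ sum-++ (map h (f x)) _ ⟩
  sum (map h (f x)) + sum (map h (concatMap f xs))
    ≡⟨ cong (sum (map h (f x)) +_) (sum-map-concatMap h f xs) ⟩
  sum (map h (f x)) + sum (map (λ x → sum (map h (f x))) xs) ∎
  where open ≡-Reasoning

length≡sum-map-1 : ∀ {A : Set} (xs : List A) → length xs ≡ sum (map (λ _ → 1) xs)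
length≡sum-map-1 []       = refl
length≡sum-map-1 (x ∷ xs) = cong suc (length≡sum-map-1 xs)

module GeneratingTree {Node : Set} (children : ℕ → Node → List Node) where

  grow : ℕ → ℕ → List Node → List Node
  grow n zero    nodes = nodes
  grow n (suc m) nodes = grow (suc n) m (concatMap (children n) nodes)

  module Census {State : Set} (state : Node → State) (rule : State → List State)
                (state-children : ∀ n e → map state (children n e) ≡ rule (state e)) where

    descendants : ℕ → State → ℕ
    descendants zero    s = 1
    descendants (suc m) s = sum (map (descendants m) (rule s))

    length-grow : ∀ n m nodes → length (grow n m nodes) ≡ sum (map (descendants m ∘ state) nodes)
    length-grow n zero    nodes = length≡sum-map-1 nodes
    length-grow n (suc m) nodes = begin
      length (grow (suc n) m (concatMap (children n) nodes))
        ≡⟨ length-grow (suc n) m (concatMap (children n) nodes) ⟩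
      sum (map (descendants m ∘ state) (concatMap (children n) nodes))
        ≡⟨ sum-map-concatMap (descendants m ∘ state) (children n) nodes ⟩
      sum (map (λ e → sum (map (descendants m ∘ state) (children n e))) nodes)
        ≡⟨ cong sum (map-cong grandchildren nodes) ⟩
      sum (map (descendants (suc m) ∘ state) nodes) ∎
      where
      open ≡-Reasoning
      grandchildren : ∀ e → sum (map (descendants m ∘ state) (children n e)) ≡
                            descendants (suc m) (state e)
      grandchildren e =
        cong sum (trans (map-∘ (children n e)) (cong (map (descendants m)) (state-children n e)))

  module Enumeration
    (word : Node → List ℕ) (Good : ℕ → List ℕ → Set) (Valid : ℕ → Node → Set)
    (valid⇒good : ∀ {n e} → Valid n e → Good n (word e))
    (parent : ℕ → List ℕ → List ℕ)
    (children-valid : ∀ {n e} → Valid (suc n) e →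
                      ∀ {e′} → e′ ∈ children (suc n) e → Valid (suc (suc n)) e′)
    (parent-children : ∀ {n e} → Valid (suc n) e →
                       ∀ {e′} → e′ ∈ children (suc n) e → parent (suc n) (word e′) ≡ word e)
    (children-distinct : ∀ {n e} → Valid (suc n) e → Unique (map word (children (suc n) e)))
    (parent-good : ∀ {n v} → Good (suc (suc n)) v → Good (suc n) (parent (suc n) v))
    (child-exists : ∀ {n v e} → Good (suc (suc n)) v → Valid (suc n) e → word e ≡ parent (suc n) v →
                    ∃ λ e′ → e′ ∈ children (suc n) e × word e′ ≡ v)
    where

    record Enumerates (n : ℕ) (nodes : List Node) : Set where
      field
        distinct : Unique (map word nodes)
        sound    : ∀ {e} → e ∈ nodes → Valid n e
        complete : ∀ {v} → Good n v → ∃ λ e → e ∈ nodes × word e ≡ v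

    enumerates⇒HasCard : ∀ {n nodes} → Enumerates n nodes → HasCard (Good n) (length nodes)
    enumerates⇒HasCard {n} {nodes} en =
      map word nodes , distinct , (λ v → mk⇔ (listed⇒good v) (good⇒listed v)) , length-map word nodes
      where
      open Enumerates en
      listed⇒good : ∀ v → v ∈ map word nodes → Good n v
      listed⇒good v v∈ with ∈-map⁻ word v∈
      ... | e , e∈ , refl = valid⇒good (sound e∈)
      good⇒listed : ∀ v → Good n v → v ∈ map word nodes
      good⇒listed v good with complete good
      ... | e , e∈ , refl = ∈-map⁺ word e∈

    distinct-concatMap : ∀ {n} nodes → (∀ {e} → e ∈ nodes → Valid (suc n) e) → Unique (map word nodes) →
                         Unique (map word (concatMap (children (suc n)) nodes))
    distinct-concatMap []          valid []              = []
    distinct-concatMap {n} (e ∷ nodes) valid (e∉ ∷ distinct) =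
      subst Unique (sym (map-++ word (children (suc n) e) (concatMap (children (suc n)) nodes)))
        (Unique.++⁺ (children-distinct (valid (here refl)))
                    (distinct-concatMap nodes (valid ∘ there) distinct) disjoint)
      where
      disjoint : ∀ {v} → ¬ (v ∈ map word (children (suc n) e) ×
                            v ∈ map word (concatMap (children (suc n)) nodes))
      disjoint (v∈₁ , v∈₂) with ∈-map⁻ word v∈₁ | ∈-map⁻ word v∈₂
      ... | e₁ , e₁∈ , refl | e₂ , e₂∈ , same with find (∈-concatMap⁻ (children (suc n)) e₂∈)
      ...   | e₃ , e₃∈ , e₂∈′ =
        All¬⇒¬Any e∉ (subst (_∈ map word nodes) (sym word-e≡word-e₃) (∈-map⁺ word e₃∈))
        where
        word-e≡word-e₃ : word e ≡ word e₃
        word-e≡word-e₃ = begin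
          word e                   ≡⟨ parent-children (valid (here refl)) e₁∈ ⟨
          parent (suc n) (word e₁) ≡⟨ cong (parent (suc n)) same ⟩
          parent (suc n) (word e₂) ≡⟨ parent-children (valid (there e₃∈)) e₂∈′ ⟩
          word e₃                  ∎
          where open ≡-Reasoning

    enumerates-children : ∀ {n nodes} → Enumerates (suc n) nodes →
                          Enumerates (suc (suc n)) (concatMap (children (suc n)) nodes)
    enumerates-children {n} {nodes} en = record
      { distinct = distinct-concatMap nodes sound distinct
      ; sound    = sound′
      ; complete = complete′
      }
      where
      open Enumerates en
      sound′ : ∀ {e′} → e′ ∈ concatMap (children (suc n)) nodes → Valid (suc (suc n)) e′
      sound′ e′∈ with find (∈-concatMap⁻ (children (suc n)) e′∈)
      ... | e , e∈ , e′∈ₑ = children-valid (sound e∈) e′∈ₑ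
      complete′ : ∀ {v} → Good (suc (suc n)) v →
                  ∃ λ e′ → e′ ∈ concatMap (children (suc n)) nodes × word e′ ≡ v
      complete′ good with complete (parent-good good)
      ... | e , e∈ , word-e with child-exists good (sound e∈) word-e
      ...   | e′ , e′∈ₑ , word-e′ = e′ , ∈-concatMap⁺ (children (suc n)) (lose e∈ e′∈ₑ) , word-e′

    enumerates-grow : ∀ m {n nodes} → Enumerates (suc n) nodes →
                      Enumerates (suc (n + m)) (grow (suc n) m nodes)
    enumerates-grow zero    {n} en = subst (λ k → Enumerates (suc k) _) (sym (+-identityʳ n)) en
    enumerates-grow (suc m) {n} {nodes} en =
      subst (λ k → Enumerates (suc k) (grow (suc n) (suc m) nodes)) (sym (+-suc n m))
        (enumerates-grow m (enumerates-children en))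

-- Ascent sequences avoiding 021 and 102

ascentAt : ℕ → ℕ → ℕ
ascentAt a b = if a <ᵇ b then 1 else 0

ascentAt-refl : ∀ m → ascentAt m m ≡ 0
ascentAt-refl zero    = refl
ascentAt-refl (suc m) = ascentAt-refl m

ascentAt-suc : ∀ m → ascentAt m (suc m) ≡ 1
ascentAt-suc zero    = refl
ascentAt-suc (suc m) = ascentAt-suc m

asc-∷ʳ-∷ʳ : ∀ w m y → asc (w ++ m ∷ y ∷ []) ≡ asc (w ++ [ m ]) + ascentAt m y
asc-∷ʳ-∷ʳ []          m y = +-identityʳ (ascentAt m y)
asc-∷ʳ-∷ʳ (a ∷ [])    m y =
  trans (cong (ascentAt a m +_) (asc-∷ʳ-∷ʳ [] m y)) (sym (+-assoc (ascentAt a m) 0 _))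
asc-∷ʳ-∷ʳ (a ∷ b ∷ w) m y =
  trans (cong (ascentAt a b +_) (asc-∷ʳ-∷ʳ (b ∷ w) m y)) (sym (+-assoc (ascentAt a b) _ _))

lookupℕ-++ˡ : ∀ (w v : List ℕ) {i} → i < length w → lookupℕ (w ++ v) i ≡ lookupℕ w i
lookupℕ-++ˡ (x ∷ w) v {zero}  _         = refl
lookupℕ-++ˡ (x ∷ w) v {suc i} (s≤s i<) = lookupℕ-++ˡ w v i<

lookupℕ-++-length : ∀ (w : List ℕ) y v → lookupℕ (w ++ y ∷ v) (length w) ≡ y
lookupℕ-++-length []      y v = refl
lookupℕ-++-length (x ∷ w) y v = lookupℕ-++-length w y v

take-++ˡ : ∀ (w v : List ℕ) {i} → i ≤ length w → take i (w ++ v) ≡ take i w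
take-++ˡ w       v {zero}  _         = refl
take-++ˡ (x ∷ w) v {suc i} (s≤s i≤) = cong (x ∷_) (take-++ˡ w v i≤)

length-∷ʳ : ∀ (w : List ℕ) y → length (w ++ [ y ]) ≡ suc (length w)
length-∷ʳ w y = trans (length-++ w) (+-comm (length w) 1)

GrowthAt : List ℕ → ℕ → Set
GrowthAt w i = lookupℕ w i ≤ asc (take i w) + 1

AscentBounded : List ℕ → Set
AscentBounded w = ∀ i → 1 ≤ i → i < length w → GrowthAt w i

isAscentSeq⇔ : ∀ x xs → IsAscentSeq (x ∷ xs) ⇔ (x ≡ 0 × AscentBounded (x ∷ xs))
isAscentSeq⇔ x xs =
  mk⇔ (λ (x≡0 , bounded) → x≡0 , fromFin bounded) (λ (x≡0 , bounded) → x≡0 , toFin bounded)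
  where
  w = x ∷ xs
  lookup≡lookupℕ : ∀ (v : List ℕ) (i : Fin (length v)) → lookup v i ≡ lookupℕ v (toℕ i)
  lookup≡lookupℕ (y ∷ v) fz     = refl
  lookup≡lookupℕ (y ∷ v) (fs i) = lookup≡lookupℕ v i
  growthAt-Fin : ∀ i → lookup w i ≤ asc (take (toℕ i) w) + 1 ⇔ GrowthAt w (toℕ i)
  growthAt-Fin i rewrite lookup≡lookupℕ w i = mk⇔ (λ h → h) (λ h → h)
  fromFin : ((i : Fin (length w)) → 1 ≤ toℕ i → lookup w i ≤ asc (take (toℕ i) w) + 1) → AscentBounded w
  fromFin bounded i 1≤i i< with fromℕ< i< | toℕ-fromℕ< i<
  ... | j | refl = Equivalence.to (growthAt-Fin j) (bounded j 1≤i)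
  toFin : AscentBounded w → (i : Fin (length w)) → 1 ≤ toℕ i → lookup w i ≤ asc (take (toℕ i) w) + 1
  toFin bounded i 1≤i = Equivalence.from (growthAt-Fin i) (bounded (toℕ i) 1≤i (toℕ<n i))

ascentBounded-∷ʳ : ∀ w y → 1 ≤ length w → AscentBounded (w ++ [ y ]) ⇔ (AscentBounded w × y ≤ asc w + 1)
ascentBounded-∷ʳ w y 1≤∣w∣ = mk⇔ to from
  where
  inside : ∀ {i} → i ≤ length w → i < length (w ++ [ y ])
  inside i≤ = subst (_ <_) (sym (length-∷ʳ w y)) (s≤s i≤)
  old : ∀ {i} → i < length w → GrowthAt (w ++ [ y ]) i ⇔ GrowthAt w i
  old i< rewrite lookupℕ-++ˡ w [ y ] i< | take-++ˡ w [ y ] (<⇒≤ i<) = mk⇔ (λ h → h) (λ h → h)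
  new : GrowthAt (w ++ [ y ]) (length w) ⇔ y ≤ asc w + 1
  new rewrite lookupℕ-++-length w y [] | take-++ˡ w [ y ] ≤-refl | take-all (length w) w ≤-refl =
    mk⇔ (λ h → h) (λ h → h)
  to : AscentBounded (w ++ [ y ]) → AscentBounded w × y ≤ asc w + 1
  to bounded = (λ i 1≤i i< → Equivalence.to (old i<) (bounded i 1≤i (inside (<⇒≤ i<)))) ,
               Equivalence.to new (bounded (length w) 1≤∣w∣ (inside ≤-refl))
  from : AscentBounded w × y ≤ asc w + 1 → AscentBounded (w ++ [ y ])
  from (bounded , y≤) i 1≤i i< with i ≟ length w
  ... | yes refl = Equivalence.from new y≤
  ... | no i≢    = Equivalence.from (old i<w) (bounded i 1≤i i<w)
    where i<w = ≤∧≢⇒< (≤-pred (subst (i <_) (length-∷ʳ w y) i<)) i≢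

isAscentSeq-∷ʳ : ∀ w y → 1 ≤ length w → IsAscentSeq (w ++ [ y ]) ⇔ (IsAscentSeq w × y ≤ asc w + 1)
isAscentSeq-∷ʳ (x ∷ xs) y 1≤∣w∣ = mk⇔
  (λ seq → let x≡0 , bounded = Equivalence.to (isAscentSeq⇔ x (xs ++ [ y ])) seq
               bounded′ , y≤ = Equivalence.to (ascentBounded-∷ʳ (x ∷ xs) y 1≤∣w∣) bounded
           in Equivalence.from (isAscentSeq⇔ x xs) (x≡0 , bounded′) , y≤)
  (λ (seq , y≤) → let x≡0 , bounded = Equivalence.to (isAscentSeq⇔ x xs) seq
                  in Equivalence.from (isAscentSeq⇔ x (xs ++ [ y ]))
                       (x≡0 , Equivalence.from (ascentBounded-∷ʳ (x ∷ xs) y 1≤∣w∣) (bounded , y≤)))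

Completes : (ℕ → ℕ → ℕ → Set) → List ℕ → ℕ → Set
Completes R w x = ∃₂ λ a b → (a ∷ b ∷ []) ⊆ w × R a b x

occurs3-∷ʳ : ∀ {R} w {x} → Occurs3 R (w ++ [ x ]) → Occurs3 R w ⊎ Completes R w x
occurs3-∷ʳ w occ with occurs3-insert w occ
... | inj₁ (a , b , c , s , r)              = inj₁ (a , b , c , subst (_ ⊆_) (++-identityʳ w) s , r)
... | inj₂ (inj₁ (_ , _ , () , _))
... | inj₂ (inj₂ (inj₁ (_ , _ , _ , () , _)))
... | inj₂ (inj₂ (inj₂ completes))          = inj₂ completes

avoids-∷ʳ : ∀ {p R} → (∀ {w} → Contains w p ⇔ Occurs3 R w) →
            ∀ w x → Avoids (w ++ [ x ]) p ⇔ (Avoids w p × ¬ Completes R w x)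
avoids-∷ʳ {p} {R} contains⇔ w x = mk⇔ to from
  where
  to : Avoids (w ++ [ x ]) p → Avoids w p × ¬ Completes R w x
  to avoids = (λ c → avoids (contains-⊆ {p = p} (++⁺ʳ [ x ] ⊆-refl) c)) ,
              (λ (a , b , s , r) →
                 avoids (Equivalence.from contains⇔ (a , b , x , ++⁺ s (refl ∷ []) , r)))
  from : Avoids w p × ¬ Completes R w x → Avoids (w ++ [ x ]) p
  from (avoids , ¬completes) c with occurs3-∷ʳ w (Equivalence.to contains⇔ c)
  ... | inj₁ occ       = avoids (Equivalence.from contains⇔ occ)
  ... | inj₂ completes = ¬completes completes

AscentExtension : ℕ → List ℕ → ℕ → Set
AscentExtension n w x =
  AscAvoid021-102 n w × x ≤ asc w + 1 × ¬ Completes Shape021 w x × ¬ Completes Shape102 w x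

ascAvoid-∷ʳ : ∀ {n} w x → 1 ≤ length w → AscAvoid021-102 (suc n) (w ++ [ x ]) ⇔ AscentExtension n w x
ascAvoid-∷ʳ {n} w x 1≤∣w∣ = mk⇔ to from
  where
  seq⇔ = isAscentSeq-∷ʳ w x 1≤∣w∣
  av021 = avoids-∷ʳ contains⇔occurs021 w x
  av102 = avoids-∷ʳ contains⇔occurs102 w x
  to : AscAvoid021-102 (suc n) (w ++ [ x ]) → AscentExtension n w x
  to (seq , len , a021 , a102) =
    let seq′ , x≤ = Equivalence.to seq⇔ seq
        a021′ , ¬c021 = Equivalence.to av021 a021
        a102′ , ¬c102 = Equivalence.to av102 a102
    in (seq′ , suc-injective (trans (sym (length-∷ʳ w x)) len) , a021′ , a102′) , x≤ , ¬c021 , ¬c102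
  from : AscentExtension n w x → AscAvoid021-102 (suc n) (w ++ [ x ])
  from ((seq , len , a021 , a102) , x≤ , ¬c021 , ¬c102) =
    Equivalence.from seq⇔ (seq , x≤) , trans (length-∷ʳ w x) (cong suc len) ,
    Equivalence.from av021 (a021 , ¬c021) , Equivalence.from av102 (a102 , ¬c102)

Nondecreasing : List ℕ → Set
Nondecreasing w = ∀ {a b} → (a ∷ b ∷ []) ⊆ w → a ≤ b

pair-∷ʳ⁻ : ∀ {a b x : ℕ} w → (a ∷ b ∷ []) ⊆ w ++ [ x ] → (a ∷ b ∷ []) ⊆ w ⊎ (a ∈ w × b ≡ x)
pair-∷ʳ⁻ w s with ⊆-++-∷⁻ w s
... | inj₁ s′                              = inj₁ (subst (_ ⊆_) (++-identityʳ w) s′)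
... | inj₂ (_ ∷ [] , [] , refl , s₁ , _)   = inj₂ (to∈ s₁ , refl)
... | inj₂ ([] , _ , refl , _ , ())
... | inj₂ (_ ∷ _ ∷ [] , _ , () , _)
... | inj₂ (_ ∷ _ ∷ _ ∷ _ , _ , () , _)

-- rising m : a staircase 0…0 1…1 … m…m, so that asc w = m;
-- binary   : the staircase fell from 1 to 0, and only 0s and 1s may follow;
-- zeros    : the staircase fell from some m ≥ 2 to 0, and only 0s may follow.
data AscentState : Set where
  rising       : ℕ → AscentState
  binary zeros : AscentState

AscentNode : Set
AscentNode = AscentState × List ℕ

descend : ℕ → List ℕ → List AscentNode
descend zero          w = []
descend (suc zero)    w = (binary , w ++ [ 0 ]) ∷ []
descend (suc (suc _)) w = (zeros , w ++ [ 0 ]) ∷ []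

ascentChildren : ℕ → AscentNode → List AscentNode
ascentChildren _ (rising m , w) =
  (rising m , w ++ [ m ]) ∷ (rising (suc m) , w ++ [ suc m ]) ∷ descend m w
ascentChildren _ (binary   , w) = (binary , w ++ [ 0 ]) ∷ (binary , w ++ [ 1 ]) ∷ []
ascentChildren _ (zeros    , w) = (zeros , w ++ [ 0 ]) ∷ []

record Rising (m : ℕ) (w : List ℕ) : Set where
  field
    asc≡        : asc w ≡ m
    bounded     : All (_≤ m) w
    sorted      : Nondecreasing w
    ends        : ∃ λ w′ → w ≡ w′ ++ [ m ]
    one∈        : 1 ≤ m → 1 ∈ w
    zero-then-m : 1 ≤ m → (0 ∷ m ∷ []) ⊆ w

-- After a fall, a subsequence 1 0 rules out every letter ≥ 2 (as 102), and a subsequence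
-- 0 e with e ≥ 2 rules out the letter 1 (as 021).
AscentInv : AscentNode → Set
AscentInv (rising m , w) = Rising m w
AscentInv (binary   , w) = All (_≤ 1) w × (1 ∷ 0 ∷ []) ⊆ w
AscentInv (zeros    , w) = (∃ λ e → 2 ≤ e × (0 ∷ e ∷ []) ⊆ w) × (1 ∷ 0 ∷ []) ⊆ w

AscentValid : ℕ → AscentNode → Set
AscentValid n e = AscentInv e × AscAvoid021-102 n (proj₂ e)

nondecreasing-∷ʳ : ∀ {w x} → Nondecreasing w → All (_≤ x) w → Nondecreasing (w ++ [ x ])
nondecreasing-∷ʳ {w} sorted ≤x s with pair-∷ʳ⁻ w s
... | inj₁ s′         = sorted s′
... | inj₂ (a∈ , refl) = All.lookup ≤x a∈

zero-completes-nothing : ∀ {w} → ¬ Completes Shape021 w 0 × ¬ Completes Shape102 w 0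
zero-completes-nothing = (λ { (_ , _ , _ , () , _) }) , (λ { (_ , _ , _ , _ , ()) })

rising-last∈ : ∀ {m w} → Rising m w → m ∈ w
rising-last∈ r with Rising.ends r
... | w′ , refl = ∈-++⁺ʳ w′ (here refl)

rising-zero∈ : ∀ {m w} → Rising m w → 0 ∈ w
rising-zero∈ {zero}  r = rising-last∈ r
rising-zero∈ {suc m} r = to∈ (Rising.zero-then-m r (s≤s z≤n))

rising-one∈-step : ∀ {m w} → Rising m w → 1 ∈ w ++ [ suc m ]
rising-one∈-step {zero}  {w} r = ∈-++⁺ʳ w (here refl)
rising-one∈-step {suc m}     r = ∈-++⁺ˡ (Rising.one∈ r (s≤s z≤n))

module _ {m w} (r : Rising m w) where
  open Rising r

  rising-asc : ∀ x → asc (w ++ [ x ]) ≡ m + ascentAt m x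
  rising-asc x with ends
  ... | w′ , refl = begin
    asc ((w′ ++ [ m ]) ++ [ x ])   ≡⟨ cong asc (++-assoc w′ [ m ] [ x ]) ⟩
    asc (w′ ++ m ∷ x ∷ [])         ≡⟨ asc-∷ʳ-∷ʳ w′ m x ⟩
    asc (w′ ++ [ m ]) + ascentAt m x ≡⟨ cong (_+ ascentAt m x) asc≡ ⟩
    m + ascentAt m x              ∎
    where open ≡-Reasoning

  rising-completes-nothing : ∀ {x} → m ≤ x → ¬ Completes Shape021 w x × ¬ Completes Shape102 w x
  rising-completes-nothing m≤x =
    (λ (a , b , s , _ , x<b) →
       <-irrefl refl (≤-<-trans (All.lookup bounded (to∈ (∷ˡ⁻ s))) (≤-<-trans m≤x x<b))) ,
    (λ (a , b , s , b<a , _) → <-irrefl refl (≤-<-trans (sorted s) b<a))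

  rising-stay : Rising m (w ++ [ m ])
  rising-stay = record
    { asc≡     = trans (rising-asc m) (trans (cong (m +_) (ascentAt-refl m)) (+-identityʳ m))
    ; bounded  = All-++⁺ bounded (≤-refl ∷ [])
    ; sorted   = nondecreasing-∷ʳ sorted bounded
    ; ends     = w , refl
    ; one∈     = λ 1≤m → ∈-++⁺ˡ (one∈ 1≤m)
    ; zero-then-m = λ 1≤m → ++⁺ʳ [ m ] (zero-then-m 1≤m)
    }

  rising-step : Rising (suc m) (w ++ [ suc m ])
  rising-step = record
    { asc≡     = trans (rising-asc (suc m)) (trans (cong (m +_) (ascentAt-suc m)) (+-comm m 1))
    ; bounded  = All-++⁺ (All.map m≤n⇒m≤1+n bounded) (≤-refl ∷ [])
    ; sorted   = nondecreasing-∷ʳ sorted (All.map m≤n⇒m≤1+n bounded)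
    ; ends     = w , refl
    ; one∈     = λ _ → rising-one∈-step r
    ; zero-then-m = λ _ → ++⁺ (from∈ (rising-zero∈ r)) (refl ∷ [])
    }

ascent-extend : ∀ {n w x} → AscAvoid021-102 (suc n) w → x ≤ asc w + 1 →
                ¬ Completes Shape021 w x × ¬ Completes Shape102 w x →
                AscAvoid021-102 (suc (suc n)) (w ++ [ x ])
ascent-extend {w = w} {x} good@(_ , len , _) x≤ (¬c021 , ¬c102) =
  Equivalence.from (ascAvoid-∷ʳ w x (subst (1 ≤_) (sym len) (s≤s z≤n))) (good , x≤ , ¬c021 , ¬c102)

ascentChildren-valid : ∀ {n e} → AscentValid (suc n) e →
                       ∀ {e′} → e′ ∈ ascentChildren (suc n) e → AscentValid (suc (suc n)) e′
ascentChildren-valid {e = rising m , w} (r , good) (here refl) =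
  rising-stay r , ascent-extend good (subst (λ k → m ≤ k + 1) (sym (Rising.asc≡ r)) (m≤m+n m 1))
                                     (rising-completes-nothing r ≤-refl)
ascentChildren-valid {e = rising m , w} (r , good) (there (here refl)) =
  rising-step r ,
  ascent-extend good (subst (λ k → suc m ≤ k + 1) (sym (Rising.asc≡ r)) (≤-reflexive (+-comm 1 m)))
                                     (rising-completes-nothing r (n≤1+n m))
ascentChildren-valid {e = rising (suc zero) , w} (r , good) (there (there (here refl))) =
  (All-++⁺ (Rising.bounded r) (z≤n ∷ []) , ++⁺ (from∈ (Rising.one∈ r ≤-refl)) (refl ∷ [])) ,
  ascent-extend good z≤n zero-completes-nothing
ascentChildren-valid {e = rising (suc (suc k)) , w} (r , good) (there (there (here refl))) =
  ((suc (suc k) , s≤s (s≤s z≤n) , ++⁺ʳ [ 0 ] (Rising.zero-then-m r (s≤s z≤n))) ,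
   ++⁺ (from∈ (Rising.one∈ r (s≤s z≤n))) (refl ∷ [])) ,
  ascent-extend good z≤n zero-completes-nothing
ascentChildren-valid {e = binary , w} ((≤1 , one-zero) , good) (here refl) =
  (All-++⁺ ≤1 (z≤n ∷ []) , ++⁺ʳ [ 0 ] one-zero) , ascent-extend good z≤n zero-completes-nothing
ascentChildren-valid {e = binary , w} ((≤1 , one-zero) , good) (there (here refl)) =
  (All-++⁺ ≤1 (≤-refl ∷ []) , ++⁺ʳ [ 1 ] one-zero) ,
  ascent-extend good (m≤n+m 1 (asc w))
    ((λ (_ , _ , s , _ , 1<b) → <-irrefl refl (<-≤-trans 1<b (All.lookup ≤1 (to∈ (∷ˡ⁻ s))))) ,
     (λ { (_ , _ , _ , b<a , s≤s z≤n) → n≮0 b<a }))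
ascentChildren-valid {e = zeros , w} ((top , one-zero) , good) (here refl) =
  (top′ top , ++⁺ʳ [ 0 ] one-zero) , ascent-extend good z≤n zero-completes-nothing
  where
  top′ : (∃ λ e → 2 ≤ e × (0 ∷ e ∷ []) ⊆ w) → ∃ λ e → 2 ≤ e × (0 ∷ e ∷ []) ⊆ w ++ [ 0 ]
  top′ (e , 2≤e , s) = e , 2≤e , ++⁺ʳ [ 0 ] s

dropLast : List ℕ → List ℕ
dropLast []          = []
dropLast (x ∷ [])    = []
dropLast (x ∷ y ∷ w) = x ∷ dropLast (y ∷ w)

dropLast-∷ʳ : ∀ w (x : ℕ) → dropLast (w ++ [ x ]) ≡ w
dropLast-∷ʳ []          x = refl
dropLast-∷ʳ (a ∷ [])    x = refl
dropLast-∷ʳ (a ∷ b ∷ w) x = cong (a ∷_) (dropLast-∷ʳ (b ∷ w) x)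

ascentChildren-∷ʳ : ∀ {n s w e′} → e′ ∈ ascentChildren n (s , w) → ∃ λ x → proj₂ e′ ≡ w ++ [ x ]
ascentChildren-∷ʳ {s = rising m}          (here refl)                = m , refl
ascentChildren-∷ʳ {s = rising m}          (there (here refl))        = suc m , refl
ascentChildren-∷ʳ {s = rising (suc zero)} (there (there (here refl))) = 0 , refl
ascentChildren-∷ʳ {s = rising (suc (suc _))} (there (there (here refl))) = 0 , refl
ascentChildren-∷ʳ {s = binary}            (here refl)                = 0 , refl
ascentChildren-∷ʳ {s = binary}            (there (here refl))        = 1 , refl
ascentChildren-∷ʳ {s = zeros}             (here refl)                = 0 , refl

∷ʳ-≢ : ∀ w {x y : ℕ} → x ≢ y → w ++ [ x ] ≢ w ++ [ y ]
∷ʳ-≢ w x≢y eq = x≢y (∷ʳ-injectiveʳ w w eq)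

ascentChildren-distinct : ∀ {n} e → Unique (map proj₂ (ascentChildren n e))
ascentChildren-distinct (rising zero , w)          = (∷ʳ-≢ w (λ ()) ∷ []) ∷ [] ∷ []
ascentChildren-distinct (rising (suc zero) , w)    =
  (∷ʳ-≢ w (λ ()) ∷ ∷ʳ-≢ w (λ ()) ∷ []) ∷ (∷ʳ-≢ w (λ ()) ∷ []) ∷ [] ∷ []
ascentChildren-distinct (rising (suc (suc k)) , w) =
  (∷ʳ-≢ w (<⇒≢ (n<1+n _)) ∷ ∷ʳ-≢ w (λ ()) ∷ []) ∷ (∷ʳ-≢ w (λ ()) ∷ []) ∷ [] ∷ []
ascentChildren-distinct (binary , w)               = (∷ʳ-≢ w (λ ()) ∷ []) ∷ [] ∷ []
ascentChildren-distinct (zeros , w)                = [] ∷ []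

extension-child : ∀ {n e x} → AscentInv e → AscentExtension (suc n) (proj₂ e) x →
               ∃ λ e′ → e′ ∈ ascentChildren (suc n) e × proj₂ e′ ≡ proj₂ e ++ [ x ]
extension-child {n} {e = rising m , w} {x} r (_ , x≤ , ¬c021 , _) with <-cmp x m
... | tri≈ _ refl _ = _ , here refl , refl
... | tri> _ _ m<x  = _ , there (here refl) , cong (λ y → w ++ [ y ]) (sym x≡1+m)
  where
  x≡1+m : x ≡ suc m
  x≡1+m = ≤-antisym (subst (x ≤_) (trans (cong (_+ 1) (Rising.asc≡ r)) (+-comm m 1)) x≤) m<x
... | tri< x<m _ _ = below m x x<m (Rising.zero-then-m r) ¬c021
  where
  below : ∀ m x → x < m → (1 ≤ m → (0 ∷ m ∷ []) ⊆ w) → ¬ Completes Shape021 w x →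
          ∃ λ e′ → e′ ∈ ascentChildren (suc n) (rising m , w) × proj₂ e′ ≡ w ++ [ x ]
  below (suc zero)    zero    _   _   _    = _ , there (there (here refl)) , refl
  below (suc (suc _)) zero    _   _   _    = _ , there (there (here refl)) , refl
  below (suc m)       (suc x) x<m top ¬c = ⊥-elim (¬c (0 , suc m , top (s≤s z≤n) , s≤s z≤n , x<m))
extension-child {e = binary , w} {zero}        _ _ = _ , here refl , refl
extension-child {e = binary , w} {suc zero}    _ _ = _ , there (here refl) , refl
extension-child {e = binary , w} {suc (suc x)} (_ , one-zero) (_ , _ , _ , ¬c102) =
  ⊥-elim (¬c102 (1 , 0 , one-zero , s≤s z≤n , s≤s (s≤s z≤n)))
extension-child {e = zeros , w} {zero}        _ _ = _ , here refl , refl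
extension-child {e = zeros , w} {suc zero}    ((e , 2≤e , zero-then-m) , _) (_ , _ , ¬c021 , _) =
  ⊥-elim (¬c021 (0 , e , zero-then-m , s≤s z≤n , 2≤e))
extension-child {e = zeros , w} {suc (suc x)} (_ , one-zero) (_ , _ , _ , ¬c102) =
  ⊥-elim (¬c102 (1 , 0 , one-zero , s≤s z≤n , s≤s (s≤s z≤n)))

ascent-unsnoc : ∀ {n} w x → AscAvoid021-102 (suc (suc n)) (w ++ [ x ]) → AscentExtension (suc n) w x
ascent-unsnoc w x good@(_ , len , _) = Equivalence.to (ascAvoid-∷ʳ w x 1≤∣w∣) good
  where
  1≤∣w∣ : 1 ≤ length w
  1≤∣w∣ = subst (1 ≤_) (sym (suc-injective (trans (sym (length-∷ʳ w x)) len))) (s≤s z≤n)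

ascent-parent-good : ∀ {n v} → AscAvoid021-102 (suc (suc n)) v → AscAvoid021-102 (suc n) (dropLast v)
ascent-parent-good {v = v} good with initLast v
ascent-parent-good (_ , () , _) | []
... | w ∷ʳ′ x = subst (AscAvoid021-102 _) (sym (dropLast-∷ʳ w x)) (proj₁ (ascent-unsnoc w x good))

ascent-child-exists : ∀ {n v e} → AscAvoid021-102 (suc (suc n)) v → AscentValid (suc n) e →
                      proj₂ e ≡ dropLast v →
                      ∃ λ e′ → e′ ∈ ascentChildren (suc n) e × proj₂ e′ ≡ v
ascent-child-exists {v = v} {_ , u} good valid word≡ with initLast v
ascent-child-exists (_ , () , _) _ _ | []
... | w ∷ʳ′ x with trans word≡ (dropLast-∷ʳ w x)
...   | refl = extension-child (proj₁ valid) (ascent-unsnoc w x good)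

ascentChildren-parent : ∀ {n e e′} → e′ ∈ ascentChildren n e → dropLast (proj₂ e′) ≡ proj₂ e
ascentChildren-parent {n} {e = s , w} e′∈ with ascentChildren-∷ʳ {n} {s} e′∈
... | x , eq = trans (cong dropLast eq) (dropLast-∷ʳ w x)

suc-C-2 : ∀ n → suc n C 2 ≡ n + n C 2
suc-C-2 n = trans (sym (nCk+nC[k+1]≡[n+1]C[k+1] n 1)) (cong (_+ n C 2) (nC1≡n n))

module Ascents where
  open GeneratingTree ascentChildren public
  open Enumeration proj₂ AscAvoid021-102 AscentValid proj₂ (λ _ → dropLast)
    ascentChildren-valid
    (λ {n} {e} _ → ascentChildren-parent {suc n} {e})
    (λ {n} {e} _ → ascentChildren-distinct {suc n} e)
    ascent-parent-good ascent-child-exists public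

  root : AscentNode
  root = rising 0 , 0 ∷ []

  root-enumerates : Enumerates 1 (root ∷ [])
  root-enumerates = record
    { distinct = [] ∷ []
    ; sound    = λ { (here refl) → rising₀ , good }
    ; complete = λ { {x ∷ []} ((refl , _) , _) → root , here refl , refl }
    }
    where
    rising₀ : Rising 0 (0 ∷ [])
    rising₀ = record
      { asc≡ = refl ; bounded = z≤n ∷ [] ; sorted = λ s → contradiction (length-mono-≤ s) λ { (s≤s ()) }
      ; ends = [] , refl ; one∈ = λ () ; zero-then-m = λ () }
    good : AscAvoid021-102 1 (0 ∷ [])
    good = (refl , λ { fz () }) , refl , shorter-avoids (s≤s (s≤s z≤n)) , shorter-avoids (s≤s (s≤s z≤n))

  rule : AscentState → List AscentState
  rule (rising zero)          = rising 0 ∷ rising 1 ∷ []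
  rule (rising (suc zero))    = rising 1 ∷ rising 2 ∷ binary ∷ []
  rule (rising (suc (suc k))) = rising (2 + k) ∷ rising (3 + k) ∷ zeros ∷ []
  rule binary                 = binary ∷ binary ∷ []
  rule zeros                  = zeros ∷ []

  state-children : ∀ n e → map proj₁ (ascentChildren n e) ≡ rule (proj₁ e)
  state-children n (rising zero , w)          = refl
  state-children n (rising (suc zero) , w)    = refl
  state-children n (rising (suc (suc k)) , w) = refl
  state-children n (binary , w)               = refl
  state-children n (zeros , w)                = refl

  open Census proj₁ rule state-children public

  zeros-descendants : ∀ m → descendants m zeros ≡ 1
  zeros-descendants zero    = refl
  zeros-descendants (suc m) = cong (_+ 0) (zeros-descendants m)

  binary-descendants : ∀ m → descendants m binary ≡ 2 ^ m
  binary-descendants zero    = refl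
  binary-descendants (suc m) = cong (λ p → p + (p + 0)) (binary-descendants m)

  rising₂-descendants : ∀ m k → descendants m (rising (2 + k)) + 1 ≡ 2 ^ suc m
  rising₂-descendants zero    k = refl
  rising₂-descendants (suc m) k = begin
    r + (r′ + (z + 0)) + 1
      ≡⟨ cong (λ z → r + (r′ + (z + 0)) + 1) (zeros-descendants m) ⟩
    r + (r′ + 1) + 1
      ≡⟨ regroup r r′ ⟩
    (r + 1) + (r′ + 1)
      ≡⟨ cong₂ _+_ (rising₂-descendants m k) (rising₂-descendants m (suc k)) ⟩
    2 ^ suc m + 2 ^ suc m
      ≡⟨ double (2 ^ suc m) ⟩
    2 ^ suc (suc m) ∎
    where
    open ≡-Reasoning
    r  = descendants m (rising (2 + k))
    r′ = descendants m (rising (3 + k))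
    z  = descendants m zeros
    regroup : ∀ r r′ → r + (r′ + 1) + 1 ≡ (r + 1) + (r′ + 1)
    regroup = solve-∀
    double : ∀ p → p + p ≡ 2 * p
    double = solve-∀

  rising₁-descendants : ∀ m → descendants m (rising 1) + m + 2 ≡ 3 * 2 ^ m
  rising₁-descendants zero    = refl
  rising₁-descendants (suc m) = begin
    r₁ + (r₂ + (b + 0)) + suc m + 2
      ≡⟨ regroup r₁ r₂ b m ⟩
    (r₁ + m + 2) + (r₂ + 1) + b
      ≡⟨ cong₂ _+_ (cong₂ _+_ (rising₁-descendants m) (rising₂-descendants m 0)) (binary-descendants m) ⟩
    3 * 2 ^ m + 2 * 2 ^ m + 2 ^ m
      ≡⟨ six (2 ^ m) ⟩
    3 * 2 ^ suc m ∎
    where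
    open ≡-Reasoning
    r₁ = descendants m (rising 1)
    r₂ = descendants m (rising 2)
    b  = descendants m binary
    regroup : ∀ r₁ r₂ b m → r₁ + (r₂ + (b + 0)) + suc m + 2 ≡ (r₁ + m + 2) + (r₂ + 1) + b
    regroup = solve-∀
    six : ∀ p → 3 * p + 2 * p + p ≡ 3 * (2 * p)
    six = solve-∀

  rising₀-descendants : ∀ m → descendants m (rising 0) + suc (suc m) C 2 + 1 ≡ 3 * 2 ^ m
  rising₀-descendants zero    = refl
  rising₀-descendants (suc m) = begin
    r₀ + (r₁ + 0) + suc (suc (suc m)) C 2 + 1
      ≡⟨ cong (λ c → r₀ + (r₁ + 0) + c + 1) (suc-C-2 (suc (suc m))) ⟩
    r₀ + (r₁ + 0) + (suc (suc m) + c) + 1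
      ≡⟨ regroup r₀ r₁ c m ⟩
    (r₀ + c + 1) + (r₁ + m + 2)
      ≡⟨ cong₂ _+_ (rising₀-descendants m) (rising₁-descendants m) ⟩
    3 * 2 ^ m + 3 * 2 ^ m
      ≡⟨ six (2 ^ m) ⟩
    3 * 2 ^ suc m ∎
    where
    open ≡-Reasoning
    r₀ = descendants m (rising 0)
    r₁ = descendants m (rising 1)
    c  = suc (suc m) C 2
    regroup : ∀ r₀ r₁ c m → r₀ + (r₁ + 0) + (suc (suc m) + c) + 1 ≡ (r₀ + c + 1) + (r₁ + m + 2)
    regroup = solve-∀
    six : ∀ p → 3 * p + 3 * p ≡ 3 * (2 * p)
    six = solve-∀

-- Permutations avoiding 123 and 3241

oneTo : ℕ → List ℕ
oneTo n = map suc (upTo n)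

oneTo-∷ʳ : ∀ n → oneTo (suc n) ≡ oneTo n ++ [ suc n ]
oneTo-∷ʳ n = trans (cong (map suc) (sym (upTo-∷ʳ n))) (map-++ suc (upTo n) [ n ])

∈-oneTo⁻ : ∀ {n x} → x ∈ oneTo n → x ≤ n
∈-oneTo⁻ x∈ with ∈-map⁻ suc x∈
... | _ , i∈ , refl = ∈-upTo⁻ i∈

↭-oneTo⇒bounded : ∀ {n w} → w ↭ oneTo n → All (_≤ n) w
↭-oneTo⇒bounded w↭ = All.tabulate (λ x∈ → ∈-oneTo⁻ (∈-resp-↭ w↭ x∈))

↭-oneTo-insert : ∀ n (X Y : List ℕ) → X ++ Y ↭ oneTo n → X ++ suc n ∷ Y ↭ oneTo (suc n)
↭-oneTo-insert n X Y p = subst (X ++ suc n ∷ Y ↭_) (sym (oneTo-∷ʳ n))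
  (↭-trans (shift (suc n) X Y) (↭-trans (prep (suc n) p) (∷↭∷ʳ (suc n) (oneTo n))))

↭-oneTo-delete : ∀ n (X Y : List ℕ) → X ++ suc n ∷ Y ↭ oneTo (suc n) → X ++ Y ↭ oneTo n
↭-oneTo-delete n X Y p = drop-∷ (↭-trans (↭-sym (shift (suc n) X Y))
  (↭-trans p (subst (_↭ suc n ∷ oneTo n) (sym (oneTo-∷ʳ n)) (↭-sym (∷↭∷ʳ (suc n) (oneTo n))))))

Decreasing : List ℕ → Set
Decreasing = AllPairs (λ a b → b < a)

decreasing-pair : ∀ {X a b} → Decreasing X → (a ∷ b ∷ []) ⊆ X → b < a
decreasing-pair (_ ∷ dec)     (_ ∷ʳ s)    = decreasing-pair dec s
decreasing-pair (above ∷ _)   (refl ∷ s)  = All.lookup above (to∈ s)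

Creates3241 : List ℕ → List ℕ → Set
Creates3241 X Y = ∃₂ λ c b → ∃ λ a → (c ∷ b ∷ []) ⊆ X × a ∈ Y × a < b × b < c

max-exceeds : ∀ {n x} → x ≤ n → ¬ (suc n < x)
max-exceeds x≤n N<x = <-irrefl refl (<-trans (s≤s x≤n) N<x)

module _ {n} (X Y : List ℕ) (bounded : All (_≤ n) (X ++ Y)) where

  private
    boundˡ : ∀ {x} → x ∈ X → x ≤ n
    boundˡ x∈ = All.lookup bounded (∈-++⁺ˡ x∈)
    boundʳ : ∀ {y} → y ∈ Y → y ≤ n
    boundʳ y∈ = All.lookup bounded (∈-++⁺ʳ X y∈)

  avoids123-insert : Decreasing X → Avoids (X ++ Y) (1 ∷ 2 ∷ 3 ∷ []) →
                     Avoids (X ++ suc n ∷ Y) (1 ∷ 2 ∷ 3 ∷ [])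
  avoids123-insert dec avoids c with occurs3-insert X (Equivalence.to contains⇔occurs123 c)
  ... | inj₁ occ                                   = avoids (Equivalence.from contains⇔occurs123 occ)
  ... | inj₂ (inj₁ (b , _ , s , N<b , _))          = max-exceeds (boundʳ (to∈ s)) N<b
  ... | inj₂ (inj₂ (inj₁ (_ , c , _ , c∈ , _ , N<c))) = max-exceeds (boundʳ c∈) N<c
  ... | inj₂ (inj₂ (inj₂ (_ , _ , s , a<b , _)))   = <-irrefl refl (<-trans a<b (decreasing-pair dec s))

  avoids3241-insert : ¬ Creates3241 X Y → Avoids (X ++ Y) (3 ∷ 2 ∷ 4 ∷ 1 ∷ []) →
                      Avoids (X ++ suc n ∷ Y) (3 ∷ 2 ∷ 4 ∷ 1 ∷ [])
  avoids3241-insert ¬creates avoids c with occurs4-insert X (Equivalence.to contains⇔occurs3241 c)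
  ... | inj₁ occ = avoids (Equivalence.from contains⇔occurs3241 occ)
  ... | inj₂ (inj₁ (_ , c , _ , s , _ , _ , N<c)) = max-exceeds (boundʳ (to∈ (∷ˡ⁻ s))) N<c
  ... | inj₂ (inj₂ (inj₁ (a , _ , _ , a∈ , _ , _ , N<a , _))) = max-exceeds (boundˡ a∈) N<a
  ... | inj₂ (inj₂ (inj₂ (inj₁ (a , b , d , s , d∈ , d<b , b<a , _)))) =
    ¬creates (a , b , d , s , d∈ , d<b , b<a)
  ... | inj₂ (inj₂ (inj₂ (inj₂ (_ , _ , _ , s , N<b , _)))) = max-exceeds (boundˡ (to∈ (∷ˡ⁻ s))) N<b

permAvoid-insert : ∀ {n} X Y → PermAvoid123-3241 n (X ++ Y) → Decreasing X → ¬ Creates3241 X Y →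
                   PermAvoid123-3241 (suc n) (X ++ suc n ∷ Y)
permAvoid-insert X Y (perm , a123 , a3241) dec ¬creates =
  ↭-oneTo-insert _ X Y perm ,
  avoids123-insert X Y bounded dec a123 ,
  avoids3241-insert X Y bounded ¬creates a3241
  where bounded = ↭-oneTo⇒bounded perm

-- A node (s , A , B) stands for the permutation A ++ B whose maximal decreasing prefix is A.
-- The state s records where the next maximum may be inserted: always in front and after
-- the first letter, and also directly after A in the states decreasing, aboveFirst and
-- aboveSecond (see StateInv).
data PermState : Set where
  start decreasing minFirst aboveFirst aboveSecond blocked : PermState

PermNode : Set
PermNode = PermState × List ℕ × List ℕ

permWord : PermNode → List ℕ
permWord (_ , A , B) = A ++ B

frontState afterFirstState : PermState → PermState
frontState start       = decreasing
frontState decreasing  = decreasing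
frontState minFirst    = aboveSecond
frontState aboveFirst  = aboveSecond
frontState aboveSecond = blocked
frontState blocked     = blocked
afterFirstState start    = minFirst
afterFirstState minFirst = minFirst
afterFirstState _        = blocked

atEnd : PermState → ℕ → List ℕ → List ℕ → List PermNode
atEnd decreasing  N A B = (aboveFirst , A , N ∷ B) ∷ []
atEnd aboveFirst  N A B = (aboveFirst , A , N ∷ B) ∷ []
atEnd aboveSecond N A B = (aboveSecond , A , N ∷ B) ∷ []
atEnd _           _ _ _ = []

permChildren : ℕ → PermNode → List PermNode
permChildren n (s , A , B) =
  (frontState s , suc n ∷ A , B) ∷
  (afterFirstState s , take 1 A , suc n ∷ drop 1 A ++ B) ∷
  atEnd s (suc n) A B

Leading2 : (ℕ → ℕ → Set) → List ℕ → Set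
Leading2 P A = ∃₂ λ a₀ a₁ → ∃ λ A′ → A ≡ a₀ ∷ a₁ ∷ A′ × P a₀ a₁

Single : (ℕ → Set) → List ℕ → Set
Single P A = ∃ λ a → A ≡ a ∷ [] × P a

Below : List ℕ → ℕ → Set
Below B a = Any (_< a) B

StateInv : PermState → List ℕ → List ℕ → Set
StateInv start       A B = A ≡ 1 ∷ [] × B ≡ []
StateInv decreasing  A B = Leading2 (λ _ _ → ⊤) A × B ≡ []
StateInv minFirst    A B = Single (λ a → All (a <_) B) A × B ≢ []
StateInv aboveFirst  A B = Leading2 (λ a₀ _ → All (a₀ <_) B) A × B ≢ []
StateInv aboveSecond A B = Leading2 (λ a₀ a₁ → All (a₁ <_) B × Below B a₀) A
StateInv blocked     A B = Single (Below B) A ⊎ Leading2 (λ _ a₁ → Below B a₁) A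

Maximal : List ℕ → List ℕ → Set
Maximal A []      = ⊤
Maximal A (b ∷ _) = Any (_< b) A

PermInv : PermNode → Set
PermInv (s , A , B) = Decreasing A × Maximal A B × StateInv s A B

nonempty-below : ∀ {N B} → B ≢ [] → All (_< N) B → Below B N
nonempty-below {B = []}    B≢[] _          = contradiction refl B≢[]
nonempty-below {B = _ ∷ _} _    (b<N ∷ _) = here b<N

front-stateInv : ∀ s {N A B} → Decreasing A → All (_< N) B → StateInv s A B →
                 StateInv (frontState s) (N ∷ A) B
front-stateInv start       {N} _ _ (refl , refl) = (N , 1 , [] , refl , tt) , refl
front-stateInv decreasing  {N} _ _ ((a₀ , a₁ , A′ , refl , _) , refl) =
  (N , a₀ , a₁ ∷ A′ , refl , tt) , refl
front-stateInv minFirst    {N} _ <N ((a , refl , a<B) , B≢[]) =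
  N , a , [] , refl , a<B , nonempty-below B≢[] <N
front-stateInv aboveFirst  {N} _ <N ((a₀ , a₁ , A′ , refl , a₀<B) , B≢[]) =
  N , a₀ , a₁ ∷ A′ , refl , a₀<B , nonempty-below B≢[] <N
front-stateInv aboveSecond {N} _ _ (a₀ , a₁ , A′ , refl , _ , below) =
  inj₂ (N , a₀ , a₁ ∷ A′ , refl , below)
front-stateInv blocked     {N} _ _ (inj₁ (a , refl , below)) =
  inj₂ (N , a , [] , refl , below)
front-stateInv blocked     {N} ((a₁<a₀ ∷ _) ∷ _) _ (inj₂ (a₀ , a₁ , A′ , refl , below)) =
  inj₂ (N , a₀ , a₁ ∷ A′ , refl , Any.map (λ x<a₁ → <-trans x<a₁ a₁<a₀) below)

afterFirst-stateInv : ∀ s {N a A₁ B} → Decreasing (a ∷ A₁) → a < N → StateInv s (a ∷ A₁) B →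
                      StateInv (afterFirstState s) (a ∷ []) (N ∷ A₁ ++ B)
afterFirst-stateInv start       _ a<N (refl , refl) = (1 , refl , a<N ∷ []) , λ ()
afterFirst-stateInv minFirst    _ a<N ((a , refl , a<B) , _) = (a , refl , a<N ∷ a<B) , λ ()
afterFirst-stateInv decreasing  ((a₁<a ∷ _) ∷ _) _ ((a , _ , _ , refl , _) , refl) =
  inj₁ (a , refl , there (here a₁<a))
afterFirst-stateInv aboveFirst  ((a₁<a ∷ _) ∷ _) _ ((a , _ , _ , refl , _) , _) =
  inj₁ (a , refl , there (here a₁<a))
afterFirst-stateInv aboveSecond ((a₁<a ∷ _) ∷ _) _ (a , _ , _ , refl , _) =
  inj₁ (a , refl , there (here a₁<a))
afterFirst-stateInv blocked     ((a₁<a ∷ _) ∷ _) _ (inj₂ (a , _ , _ , refl , _)) =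
  inj₁ (a , refl , there (here a₁<a))
afterFirst-stateInv blocked     _ _ (inj₁ (a , refl , below)) =
  inj₁ (a , refl , there below)

PermValid : ℕ → PermNode → Set
PermValid n e = PermInv e × PermAvoid123-3241 n (permWord e)

short-creates-no3241 : ∀ {X Y} → length X ≤ 1 → ¬ Creates3241 X Y
short-creates-no3241 ∣X∣≤1 (_ , _ , _ , s , _) = ≤⇒≯ ∣X∣≤1 (length-mono-≤ s)

no-3241-at-end : ∀ {a₀ a₁ A′ B} → Decreasing (a₀ ∷ a₁ ∷ A′) → All (a₁ <_) B →
                 ¬ Creates3241 (a₀ ∷ a₁ ∷ A′) B
no-3241-at-end {a₁ = a₁} (_ ∷ (a₁>A′ ∷ _)) a₁<B (_ , b , a , s , a∈ , a<b , _) =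
  <-irrefl refl (<-≤-trans (All.lookup a₁<B a∈) (≤-trans (<⇒≤ a<b) (≤a₁ (to∈ (second s)))))
  where
  second : ∀ {c b x xs} → (c ∷ b ∷ []) ⊆ x ∷ xs → (b ∷ []) ⊆ xs
  second (_ ∷ʳ s) = ∷ˡ⁻ s
  second (_ ∷ s)  = s
  ≤a₁ : ∀ {b} → b ∈ a₁ ∷ _ → b ≤ a₁
  ≤a₁ (here refl) = ≤-refl
  ≤a₁ (there b∈)  = <⇒≤ (All.lookup a₁>A′ b∈)

stateInv-[] : ∀ s {B} → ¬ StateInv s [] B
stateInv-[] start       (() , _)
stateInv-[] decreasing  ((_ , _ , _ , () , _) , _)
stateInv-[] minFirst    ((_ , () , _) , _)
stateInv-[] aboveFirst  ((_ , _ , _ , () , _) , _)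
stateInv-[] aboveSecond (_ , _ , _ , () , _)
stateInv-[] blocked     (inj₁ (_ , () , _))
stateInv-[] blocked     (inj₂ (_ , _ , _ , () , _))

letters-below-max : ∀ {n w} → PermAvoid123-3241 n w → All (_< suc n) w
letters-below-max (perm , _) = All.map s≤s (↭-oneTo⇒bounded perm)

letter-below-max : ∀ {n w x} → PermAvoid123-3241 n w → x ∈ w → x < suc n
letter-below-max good = All.lookup (letters-below-max good)

front-valid : ∀ {n s A B} → PermValid n (s , A , B) →
              PermValid (suc n) (frontState s , suc n ∷ A , B)
front-valid {n} {s} {A} {B} ((dec , maximal , inv) , good) =
  (All-++⁻ˡ A <N ∷ dec , maximal-front B maximal , front-stateInv s dec (All-++⁻ʳ A <N) inv) ,
  permAvoid-insert [] (A ++ B) good [] (short-creates-no3241 z≤n)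
  where
  <N = letters-below-max good
  maximal-front : ∀ B → Maximal A B → Maximal (suc n ∷ A) B
  maximal-front []      _ = tt
  maximal-front (_ ∷ _) m = there m

afterFirst-valid : ∀ {n s A B} → PermValid n (s , A , B) →
                   PermValid (suc n) (afterFirstState s , take 1 A , suc n ∷ drop 1 A ++ B)
afterFirst-valid {s = s} {[]}              ((_ , _ , inv) , _) = contradiction inv (stateInv-[] s)
afterFirst-valid {n} {s} {a ∷ A₁} {B} ((dec , _ , inv) , good) with letters-below-max good
... | a<N ∷ _ =
  ([] ∷ [] , here a<N , afterFirst-stateInv s dec a<N inv) ,
  permAvoid-insert (a ∷ []) (A₁ ++ B) good ([] ∷ []) (short-creates-no3241 ≤-refl)

atEnd-valid : ∀ {n s A B e′} → PermValid n (s , A , B) → e′ ∈ atEnd s (suc n) A B →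
              PermValid (suc n) e′
atEnd-valid {n} {decreasing} ((dec , _ , ((a₀ , a₁ , A′ , refl , _) , refl)) , good) (here refl)
  with letters-below-max good
... | a₀<N ∷ _ =
  (dec , here a₀<N , (a₀ , a₁ , A′ , refl , a₀<N ∷ []) , λ ()) ,
  permAvoid-insert (a₀ ∷ a₁ ∷ A′) [] good dec (no-3241-at-end dec [])
atEnd-valid {n} {aboveFirst} {B = B}
  ((dec@((a₁<a₀ ∷ _) ∷ _) , _ , ((a₀ , a₁ , A′ , refl , a₀<B) , _)) , good) (here refl)
  with letters-below-max good
... | a₀<N ∷ _ =
  (dec , here a₀<N , (a₀ , a₁ , A′ , refl , a₀<N ∷ a₀<B) , λ ()) ,
  permAvoid-insert (a₀ ∷ a₁ ∷ A′) B good dec (no-3241-at-end dec (All.map (<-trans a₁<a₀) a₀<B))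
atEnd-valid {n} {aboveSecond} {B = B}
  ((dec , _ , (a₀ , a₁ , A′ , refl , a₁<B , below)) , good) (here refl)
  with letters-below-max good
... | a₀<N ∷ a₁<N ∷ _ =
  (dec , here a₀<N , a₀ , a₁ , A′ , refl , a₁<N ∷ a₁<B , there below) ,
  permAvoid-insert (a₀ ∷ a₁ ∷ A′) B good dec (no-3241-at-end dec a₁<B)

permChildren-valid : ∀ {n e} → PermValid n e → ∀ {e′} → e′ ∈ permChildren n e → PermValid (suc n) e′
permChildren-valid valid (here refl)         = front-valid valid
permChildren-valid valid (there (here refl)) = afterFirst-valid valid
permChildren-valid valid (there (there e′∈)) = atEnd-valid valid e′∈

removeMax : ℕ → List ℕ → List ℕ
removeMax n = filter (_≤? n)

removeMax-insert : ∀ {n} X Y → All (_≤ n) (X ++ Y) → removeMax n (X ++ suc n ∷ Y) ≡ X ++ Y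
removeMax-insert {n} X Y bounded = begin
  removeMax n (X ++ suc n ∷ Y)                 ≡⟨ filter-++ (_≤? n) X (suc n ∷ Y) ⟩
  removeMax n X ++ removeMax n (suc n ∷ Y)     ≡⟨ cong₂ _++_ (filter-all (_≤? n) (All-++⁻ˡ X bounded))
                                                               (filter-reject (_≤? n) (<-irrefl refl)) ⟩
  X ++ removeMax n Y                           ≡⟨ cong (X ++_) (filter-all (_≤? n) (All-++⁻ʳ X bounded)) ⟩
  X ++ Y                                       ∎
  where open ≡-Reasoning

permChildren-insert : ∀ {n s A B e′} → e′ ∈ permChildren n (s , A , B) →
                      ∃₂ λ X Y → A ++ B ≡ X ++ Y × permWord e′ ≡ X ++ suc n ∷ Y
permChildren-insert {A = A} {B} (here refl)                 = [] , A ++ B , refl , refl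
permChildren-insert {A = []} {B} (there (here refl))        = [] , B , refl , refl
permChildren-insert {A = a ∷ A₁} {B} (there (here refl))    = a ∷ [] , A₁ ++ B , refl , refl
permChildren-insert {s = decreasing}  {A} {B} (there (there (here refl))) = A , B , refl , refl
permChildren-insert {s = aboveFirst}  {A} {B} (there (there (here refl))) = A , B , refl , refl
permChildren-insert {s = aboveSecond} {A} {B} (there (there (here refl))) = A , B , refl , refl

permChildren-parent : ∀ {n e} → PermValid (suc n) e → ∀ {e′} → e′ ∈ permChildren (suc n) e →
                      removeMax (suc n) (permWord e′) ≡ permWord e
permChildren-parent {n} {e = s , A , B} (_ , good) {e′} e′∈ with permChildren-insert {s = s} {A} {B} e′∈
... | X , Y , A++B≡ , word≡ = begin
  removeMax (suc n) (permWord e′)          ≡⟨ cong (removeMax (suc n)) word≡ ⟩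
  removeMax (suc n) (X ++ suc (suc n) ∷ Y) ≡⟨ removeMax-insert X Y (subst (All _) A++B≡ (↭-oneTo⇒bounded (proj₁ good))) ⟩
  X ++ Y                                   ≡⟨ A++B≡ ⟨
  A ++ B                                   ∎
  where open ≡-Reasoning

∷-≢ : ∀ {x y : ℕ} {xs ys : List ℕ} → x ≢ y → x ∷ xs ≢ y ∷ ys
∷-≢ x≢y refl = x≢y refl

max≢ : ∀ {n a} → a ≤ n → suc n ≢ a
max≢ a≤n refl = <-irrefl refl a≤n

two-children-distinct : ∀ {n a} A₁ B → a ≤ n →
  Unique {A = List ℕ} ((suc n ∷ a ∷ A₁ ++ B) ∷ (a ∷ suc n ∷ A₁ ++ B) ∷ [])
two-children-distinct _ _ a≤n = (∷-≢ (max≢ a≤n) ∷ []) ∷ [] ∷ []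

three-children-distinct : ∀ {n a₀ a₁} A′ B → a₀ ≤ n → a₁ ≤ n →
  Unique {A = List ℕ}
    ((suc n ∷ a₀ ∷ a₁ ∷ A′ ++ B) ∷ (a₀ ∷ suc n ∷ a₁ ∷ A′ ++ B) ∷ (a₀ ∷ a₁ ∷ A′ ++ suc n ∷ B) ∷ [])
three-children-distinct _ _ a₀≤n a₁≤n =
  (∷-≢ (max≢ a₀≤n) ∷ ∷-≢ (max≢ a₀≤n) ∷ []) ∷
  ((λ eq → max≢ a₁≤n (∷-injectiveˡ (∷-injectiveʳ eq))) ∷ []) ∷ [] ∷ []

permChildren-distinct : ∀ {n e} → PermValid n e → Unique (map permWord (permChildren n e))
permChildren-distinct {e = s , [] , _} ((_ , _ , inv) , _) = contradiction inv (stateInv-[] s)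
permChildren-distinct {n} {s , a ∷ A₁ , B} ((_ , _ , inv) , good)
  with ↭-oneTo⇒bounded (proj₁ good) | s | inv
... | a≤n ∷ _          | start       | _ = two-children-distinct A₁ B a≤n
... | a≤n ∷ _          | minFirst    | _ = two-children-distinct A₁ B a≤n
... | a≤n ∷ _          | blocked     | _ = two-children-distinct A₁ B a≤n
... | a₀≤n ∷ a₁≤n ∷ _ | decreasing  | ((_ , _ , A′ , refl , _) , _) = three-children-distinct A′ B a₀≤n a₁≤n
... | a₀≤n ∷ a₁≤n ∷ _ | aboveFirst  | ((_ , _ , A′ , refl , _) , _) = three-children-distinct A′ B a₀≤n a₁≤n
... | a₀≤n ∷ a₁≤n ∷ _ | aboveSecond | (_ , _ , A′ , refl , _)       = three-children-distinct A′ B a₀≤n a₁≤n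

++-≡-++⁻ : ∀ (X Y A B : List ℕ) → X ++ Y ≡ A ++ B →
           (∃ λ Z → X ≡ A ++ Z × B ≡ Z ++ Y) ⊎ (∃ λ Z → A ≡ X ++ Z × Y ≡ Z ++ B)
++-≡-++⁻ []      Y A       B eq = inj₂ (A , refl , eq)
++-≡-++⁻ (x ∷ X) Y []      B eq = inj₁ (x ∷ X , refl , sym eq)
++-≡-++⁻ (x ∷ X) Y (a ∷ A) B eq with ∷-injectiveˡ eq | ++-≡-++⁻ X Y A B (∷-injectiveʳ eq)
... | refl | inj₁ (Z , X≡ , B≡) = inj₁ (Z , cong (x ∷_) X≡ , B≡)
... | refl | inj₂ (Z , A≡ , Y≡) = inj₂ (Z , cong (x ∷_) A≡ , Y≡)

creates3241⇒occurs : ∀ {N X Y} → (∀ {c} → c ∈ X → c < N) → Creates3241 X Y → Occurs4 Shape3241 (X ++ N ∷ Y)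
creates3241⇒occurs {N} <N (c , b , a , s , a∈ , a<b , b<c) =
  c , b , N , a , ++⁺ s (refl ∷ from∈ a∈) , a<b , b<c , <N (to∈ s)

ChildWithWord : ℕ → PermNode → List ℕ → Set
ChildWithWord n e v = ∃ λ e′ → e′ ∈ permChildren n e × permWord e′ ≡ v

afterRun-child : ∀ {n s A B} → PermValid n (s , A , B) → Avoids (A ++ suc n ∷ B) (3 ∷ 2 ∷ 4 ∷ 1 ∷ []) →
                 ChildWithWord n (s , A , B) (A ++ suc n ∷ B)
afterRun-child {s = start}       ((_ , _ , refl , refl) , _) _                 = _ , there (here refl) , refl
afterRun-child {s = minFirst}    ((_ , _ , (_ , refl , _) , _) , _) _          = _ , there (here refl) , refl
afterRun-child {s = blocked}     ((_ , _ , inj₁ (_ , refl , _)) , _) _         = _ , there (here refl) , refl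
afterRun-child {s = blocked}
  ((((a₁<a₀ ∷ _) ∷ _) , _ , inj₂ (a₀ , a₁ , A′ , refl , below)) , good) avoids with find below
... | x , x∈ , x<a₁ = contradiction
  (Equivalence.from contains⇔occurs3241 (creates3241⇒occurs (letter-below-max good ∘ ∈-++⁺ˡ)
     (a₀ , a₁ , x , refl ∷ refl ∷ []⊆-universal A′ , x∈ , x<a₁ , a₁<a₀)))
  avoids
afterRun-child {s = decreasing}  _ _ = _ , there (there (here refl)) , refl
afterRun-child {s = aboveFirst}  _ _ = _ , there (there (here refl)) , refl
afterRun-child {s = aboveSecond} _ _ = _ , there (there (here refl)) , refl

insertion-child : ∀ {n s A B} X Y → PermValid n (s , A , B) → A ++ B ≡ X ++ Y →
                  PermAvoid123-3241 (suc n) (X ++ suc n ∷ Y) → ChildWithWord n (s , A , B) (X ++ suc n ∷ Y)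
insertion-child {n} {s} {A} {B} X Y ((dec , maximal , inv) , good) A++B≡ (_ , a123 , a3241)
  with ++-≡-++⁻ X Y A B (sym A++B≡)
... | inj₁ ([] , X≡ , B≡) rewrite trans X≡ (++-identityʳ A) | B≡ =
  afterRun-child ((dec , maximal , inv) , good) a3241
... | inj₂ ([] , A≡ , Y≡) rewrite trans A≡ (++-identityʳ X) | Y≡ =
  afterRun-child ((dec , maximal , inv) , good) a3241
... | inj₁ (z ∷ Z , refl , refl) with find maximal
...   | a , a∈ , a<z = contradiction
  (Equivalence.from contains⇔occurs123
    (a , z , suc n , ++⁺ (++⁺ (from∈ a∈) (refl ∷ []⊆-universal Z)) (refl ∷ []⊆-universal Y) ,
     a<z , letter-below-max good (∈-++⁺ʳ A (here refl))))
  a123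
insertion-child [] Y _ _ _ | inj₂ (z ∷ Z , refl , refl) = _ , here refl , refl
insertion-child (x ∷ []) Y _ _ _ | inj₂ (z ∷ Z , refl , refl) = _ , there (here refl) , refl
insertion-child (x₀ ∷ x₁ ∷ X′) Y (((x₁<x₀ ∷ _) ∷ (x₁>rest ∷ _) , _) , good) _ (_ , _ , a3241)
  | inj₂ (z ∷ Z , refl , refl) = contradiction
  (Equivalence.from contains⇔occurs3241 (creates3241⇒occurs (letter-below-max good ∘ ∈-++⁺ˡ ∘ ∈-++⁺ˡ)
    (x₀ , x₁ , z , refl ∷ refl ∷ []⊆-universal X′ , here refl ,
     All.lookup x₁>rest (∈-++⁺ʳ X′ (here refl)) , x₁<x₀)))
  a3241

max-split : ∀ {n v} → v ↭ oneTo (suc n) → ∃₂ λ X Y → v ≡ X ++ suc n ∷ Y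
max-split {n} perm =
  ∈-∃++ (∈-resp-↭ (↭-sym perm) (subst (suc n ∈_) (sym (oneTo-∷ʳ n)) (∈-++⁺ʳ (oneTo n) (here refl))))

perm-parent-good : ∀ {n v} → PermAvoid123-3241 (suc (suc n)) v →
                   PermAvoid123-3241 (suc n) (removeMax (suc n) v)
perm-parent-good {n} (perm , a123 , a3241) with max-split perm
... | X , Y , refl = subst (PermAvoid123-3241 (suc n)) (sym (removeMax-insert X Y (↭-oneTo⇒bounded perm′)))
  (perm′ , (λ c → a123 (contains-⊆ X++Y⊆ c)) , (λ c → a3241 (contains-⊆ X++Y⊆ c)))
  where
  perm′ = ↭-oneTo-delete (suc n) X Y perm
  X++Y⊆ : X ++ Y ⊆ X ++ suc (suc n) ∷ Y
  X++Y⊆ = ++⁺ ⊆-refl (suc (suc n) ∷ʳ ⊆-refl)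

perm-child-exists : ∀ {n v e} → PermAvoid123-3241 (suc (suc n)) v → PermValid (suc n) e →
                    permWord e ≡ removeMax (suc n) v → ChildWithWord (suc n) e v
perm-child-exists {n} good@(perm , _) valid word≡ with max-split perm
... | X , Y , refl = insertion-child X Y valid (trans word≡ (removeMax-insert X Y bounded)) good
  where bounded = ↭-oneTo⇒bounded (↭-oneTo-delete (suc n) X Y perm)

module Permutations where
  open GeneratingTree permChildren public
  open Enumeration permWord PermAvoid123-3241 PermValid proj₂ removeMax
    permChildren-valid permChildren-parent permChildren-distinct perm-parent-good perm-child-exists public

  root : PermNode
  root = start , 1 ∷ [] , []

  root-enumerates : Enumerates 1 (root ∷ [])
  root-enumerates = record
    { distinct = [] ∷ []
    ; sound    = λ { (here refl) →
        ([] ∷ [] , tt , refl , refl) , ↭-refl , shorter-avoids (s≤s (s≤s z≤n)) , shorter-avoids (s≤s (s≤s z≤n)) }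
    ; complete = λ (perm , _) → root , here refl , sym (↭-singleton-inv perm)
    }

  rule : PermState → List PermState
  rule start       = decreasing ∷ minFirst ∷ []
  rule decreasing  = decreasing ∷ blocked ∷ aboveFirst ∷ []
  rule minFirst    = aboveSecond ∷ minFirst ∷ []
  rule aboveFirst  = aboveSecond ∷ blocked ∷ aboveFirst ∷ []
  rule aboveSecond = blocked ∷ blocked ∷ aboveSecond ∷ []
  rule blocked     = blocked ∷ blocked ∷ []

  state-children : ∀ n e → map proj₁ (permChildren n e) ≡ rule (proj₁ e)
  state-children n (start , _)       = refl
  state-children n (decreasing , _)  = refl
  state-children n (minFirst , _)    = refl
  state-children n (aboveFirst , _)  = refl
  state-children n (aboveSecond , _) = refl
  state-children n (blocked , _)     = refl

  open Census proj₁ rule state-children public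

  blocked-descendants : ∀ m → descendants m blocked ≡ 2 ^ m
  blocked-descendants zero    = refl
  blocked-descendants (suc m) = cong (λ p → p + (p + 0)) (blocked-descendants m)

  aboveSecond-descendants : ∀ m → descendants m aboveSecond + 1 ≡ 2 ^ suc m
  aboveSecond-descendants zero    = refl
  aboveSecond-descendants (suc m) = begin
    b + (b + (s + 0)) + 1
      ≡⟨ regroup b s ⟩
    b + b + (s + 1)
      ≡⟨ cong₂ (λ x y → x + x + y) (blocked-descendants m) (aboveSecond-descendants m) ⟩
    2 ^ m + 2 ^ m + 2 * 2 ^ m
      ≡⟨ four (2 ^ m) ⟩
    2 ^ suc (suc m) ∎
    where
    open ≡-Reasoning
    b = descendants m blocked
    s = descendants m aboveSecond
    regroup : ∀ b s → b + (b + (s + 0)) + 1 ≡ b + b + (s + 1)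
    regroup = solve-∀
    four : ∀ p → p + p + 2 * p ≡ 2 * (2 * p)
    four = solve-∀

  aboveFirst-descendants : ∀ m → descendants m aboveFirst + m + 2 ≡ 3 * 2 ^ m
  aboveFirst-descendants zero    = refl
  aboveFirst-descendants (suc m) = begin
    s + (b + (f + 0)) + suc m + 2
      ≡⟨ regroup s b f m ⟩
    (s + 1) + b + (f + m + 2)
      ≡⟨ cong₂ _+_ (cong₂ _+_ (aboveSecond-descendants m) (blocked-descendants m)) (aboveFirst-descendants m) ⟩
    2 * 2 ^ m + 2 ^ m + 3 * 2 ^ m
      ≡⟨ six (2 ^ m) ⟩
    3 * 2 ^ suc m ∎
    where
    open ≡-Reasoning
    s = descendants m aboveSecond
    b = descendants m blocked
    f = descendants m aboveFirst
    regroup : ∀ s b f m → s + (b + (f + 0)) + suc m + 2 ≡ (s + 1) + b + (f + m + 2)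
    regroup = solve-∀
    six : ∀ p → 2 * p + p + 3 * p ≡ 3 * (2 * p)
    six = solve-∀

  minFirst-descendants : ∀ m → descendants m minFirst + m + 1 ≡ 2 ^ suc m
  minFirst-descendants zero    = refl
  minFirst-descendants (suc m) = begin
    s + (f + 0) + suc m + 1
      ≡⟨ regroup s f m ⟩
    (s + 1) + (f + m + 1)
      ≡⟨ cong₂ _+_ (aboveSecond-descendants m) (minFirst-descendants m) ⟩
    2 ^ suc m + 2 ^ suc m
      ≡⟨ double (2 ^ suc m) ⟩
    2 ^ suc (suc m) ∎
    where
    open ≡-Reasoning
    s = descendants m aboveSecond
    f = descendants m minFirst
    regroup : ∀ s f m → s + (f + 0) + suc m + 1 ≡ (s + 1) + (f + m + 1)
    regroup = solve-∀
    double : ∀ p → p + p ≡ 2 * p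
    double = solve-∀

  decreasing-descendants : ∀ m → descendants m decreasing + suc (suc m) C 2 + 2 ≡ 2 ^ suc (suc m)
  decreasing-descendants zero    = refl
  decreasing-descendants (suc m) = begin
    d + (b + (f + 0)) + suc (suc (suc m)) C 2 + 2
      ≡⟨ cong (λ c → d + (b + (f + 0)) + c + 2) (suc-C-2 (suc (suc m))) ⟩
    d + (b + (f + 0)) + (suc (suc m) + c) + 2
      ≡⟨ regroup d b f c m ⟩
    (d + c + 2) + b + (f + m + 2)
      ≡⟨ cong₂ _+_ (cong₂ _+_ (decreasing-descendants m) (blocked-descendants m)) (aboveFirst-descendants m) ⟩
    2 * (2 * 2 ^ m) + 2 ^ m + 3 * 2 ^ m
      ≡⟨ eight (2 ^ m) ⟩
    2 ^ suc (suc (suc m)) ∎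
    where
    open ≡-Reasoning
    d = descendants m decreasing
    b = descendants m blocked
    f = descendants m aboveFirst
    c = suc (suc m) C 2
    regroup : ∀ d b f c m → d + (b + (f + 0)) + (suc (suc m) + c) + 2 ≡ (d + c + 2) + b + (f + m + 2)
    regroup = solve-∀
    eight : ∀ p → 2 * (2 * p) + p + 3 * p ≡ 2 * (2 * (2 * p))
    eight = solve-∀

  start-descendants : ∀ m → descendants m start + suc (suc m) C 2 + 1 ≡ 3 * 2 ^ m
  start-descendants zero    = refl
  start-descendants (suc m) = begin
    d + (f + 0) + suc (suc (suc m)) C 2 + 1
      ≡⟨ cong (λ c → d + (f + 0) + c + 1) (suc-C-2 (suc (suc m))) ⟩
    d + (f + 0) + (suc (suc m) + c) + 1
      ≡⟨ regroup d f c m ⟩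
    (d + c + 2) + (f + m + 1)
      ≡⟨ cong₂ _+_ (decreasing-descendants m) (minFirst-descendants m) ⟩
    2 * (2 * 2 ^ m) + 2 * 2 ^ m
      ≡⟨ six (2 ^ m) ⟩
    3 * 2 ^ suc m ∎
    where
    open ≡-Reasoning
    d = descendants m decreasing
    f = descendants m minFirst
    c = suc (suc m) C 2
    regroup : ∀ d f c m → d + (f + 0) + (suc (suc m) + c) + 1 ≡ (d + c + 2) + (f + m + 1)
    regroup = solve-∀
    six : ∀ p → 2 * (2 * p) + 2 * p ≡ 3 * (2 * p)
    six = solve-∀

same-closed-form : ∀ {x y c t} → x + c + 1 ≡ t → y + c + 1 ≡ t → x ≡ y
same-closed-form {x} {y} {c} x≡ y≡ =
  +-cancelʳ-≡ c x y (+-cancelʳ-≡ 1 (x + c) (y + c) (trans x≡ (sym y≡)))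

proposition4p2 : (n : ℕ) → 1 ≤ n →
    Σ ℕ (λ k → (k + (suc n C 2) + 1 ≡ 3 * 2 ^ (n ∸ 1)) ×
               HasCard (AscAvoid021-102 n) k ×
               HasCard (PermAvoid123-3241 n) k)
proposition4p2 zero    ()
proposition4p2 (suc m) _ = k , A.rising₀-descendants m , ascents , permutations
  where
  module A = Ascents
  module P = Permutations
  k = A.descendants m (rising 0)
  ascents : HasCard (AscAvoid021-102 (suc m)) k
  ascents = subst (HasCard _) (trans (A.length-grow 1 m (A.root ∷ [])) (+-identityʳ k))
                  (A.enumerates⇒HasCard (A.enumerates-grow m A.root-enumerates))
  permutations : HasCard (PermAvoid123-3241 (suc m)) k
  permutations = subst (HasCard _)
                       (trans (P.length-grow 1 m (P.root ∷ [])) (trans (+-identityʳ _) same-count))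
                       (P.enumerates⇒HasCard (P.enumerates-grow m P.root-enumerates))
    where
    same-count : P.descendants m start ≡ k
    same-count = same-closed-form (P.start-descendants m) (A.rising₀-descendants m)
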